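{- Let $k$ be a field, $k'/k$ finite and $L=k'((t))((u))$. Then: (1) $End(L/k)$ is a $k$-algebra (under addition and composition); (2) for every positive integer $m$ there is an embedding of algebras $End(L/k)^{\oplus m}\hookrightarrow End(L/k)$; (3) for every positive integer $m$ there is an embedding of algebras $gl(m,L)\hookrightarrow End(L/k)$.
   Context: For $n\in\mathbb Z$ let $\mathcal O_n=u^nk'((t))[[u]]$. For $m<n$, $\mathcal O_m/\mathcal O_n$ is a topological $k$-vector space with base of neighbourhoods of $0$ the images of $t^lu^mk'[[t,u]]$, $l\in\mathbb Z$. $End(L/k)$ is the set of $k$-linear maps $A:L\to L$ such that: (1) for every $n$ there is $m$ with $A\mathcal O_n\subset\mathcal O_m$; (2) for every $m$ there is $n$ with $A\mathcal O_n\subset\mathcal O_m$; (3) whenever $n_1<n_2$, $m_1<m_2$ with $A\mathcal O_{n_i}\subset\mathcal O_{m_i}$ ($i=1,2$), the induced map $\mathcal O_{n_1}/\mathcal O_{n_2}\to\mathcal O_{m_1}/\mathcal O_{m_2}$ is continuous. $gl(m,L)$ denotes the algebra of $m\times m$ matrices over $L$. -}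

module Defs where

open import Level using (Level; _⊔_) renaming (suc to lsuc)
open import Data.Nat using (ℕ; zero; suc; _∸_)
open import Data.Integer using (ℤ; +_; _≤?_; _<_; ∣_∣; _⊓_) renaming (_+_ to _+ℤ_; _-_ to _-ℤ_)
open import Data.Fin using (Fin; zero; suc; _≟_)
open import Data.Product using (Σ; Σ-syntax; ∃; ∃-syntax; _×_; _,_; proj₁; proj₂)
open import Data.Sum using (_⊎_)
open import Relation.Nullary using (¬_; does)
open import Data.Bool using (if_then_else_)
open import Algebra.Bundles using (CommutativeRing)
open import Algebra.Bundles.Raw using (RawRing)
open import Algebra.Structures using (IsRing)
open import Algebra.Module.Structures using (IsModule)
open import Algebra.Morphism.Structures using (module RingMorphisms)
open import Function using (flip; _∘_; id)

record Field (c ℓ : Level) : Set (lsuc (c ⊔ ℓ)) where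
  field
    commutativeRing : CommutativeRing c ℓ
  open CommutativeRing commutativeRing public
  field
    1≉0 : ¬ (1# ≈ 0#)
    inverse : ∀ x → ¬ (x ≈ 0#) → ∃[ y ] (x * y ≈ 1#)

module _ {c ℓ} (R : RawRing c ℓ) where
  open RawRing R
  sumFin : (n : ℕ) → (Fin n → Carrier) → Carrier
  sumFin zero f = 0#
  sumFin (suc n) f = f zero + sumFin n (f ∘ suc)

  sumℕ : ℕ → (ℕ → Carrier) → Carrier    -- sum of f 0 .. f n
  sumℕ zero f = f 0
  sumℕ (suc n) f = f 0 + sumℕ n (f ∘ suc)

record FiniteExt {c ℓ c' ℓ'} (k : Field c ℓ) (k' : Field c' ℓ')
       : Set (c ⊔ ℓ ⊔ c' ⊔ ℓ') where
  private
    module k = Field k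
    module k' = Field k'
  field
    ι : k.Carrier → k'.Carrier
    ι-hom : RingMorphisms.IsRingHomomorphism k.rawRing k'.rawRing ι
    dim : ℕ
    basis : Fin dim → k'.Carrier
    spans : ∀ x → Σ[ a ∈ (Fin dim → k.Carrier) ] (x k'.≈ sumFin k'.rawRing dim (λ i → ι (a i) k'.* basis i))

-- Laurent series R((x)) over a raw ring R:
-- x^val * Σ_{n ≥ 0} co n x^n ; equality is coefficientwise.

record LS {c} (A : Set c) : Set c where
  constructor ls
  field
    val : ℤ
    co  : ℕ → A

module _ {c ℓ} (R : RawRing c ℓ) where
  open RawRing R
  open LS

  coeff : LS Carrier → ℤ → Carrier
  coeff f i = if does (val f ≤? i) then co f ∣ i -ℤ val f ∣ else 0#

  mapLS : (Carrier → Carrier) → LS Carrier → LS Carrier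
  mapLS h f = ls (val f) (h ∘ co f)

  LSRing : RawRing c ℓ
  LSRing = record
    { Carrier = LS Carrier
    ; _≈_ = λ f g → ∀ i → coeff f i ≈ coeff g i
    ; _+_ = λ f g → let v = val f ⊓ val g in
                    ls v (λ n → coeff f (v +ℤ + n) + coeff g (v +ℤ + n))
    ; _*_ = λ f g → ls (val f +ℤ val g)
                       (λ n → sumℕ R n (λ a → co f a * co g (n ∸ a)))
    ; -_ = mapLS (λ x → - x)
    ; 0# = ls (+ 0) (λ _ → 0#)
    ; 1# = ls (+ 0) (λ { zero → 1# ; (suc _) → 0# })
    }

record RawKAlg {c ℓ} (k : Field c ℓ) (a ℓa : Level) : Set (c ⊔ lsuc (a ⊔ ℓa)) where
  field
    rawRing : RawRing a ℓa
  open RawRing rawRing public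
  field
    _·_ : Field.Carrier k → Carrier → Carrier

record IsKAlgebra {c ℓ a ℓa} {k : Field c ℓ} (A : RawKAlg k a ℓa)
       : Set (c ⊔ ℓ ⊔ a ⊔ ℓa) where
  open RawKAlg A
  field
    isRing   : IsRing _≈_ _+_ _*_ -_ 0# 1#
    isModule : IsModule (Field.commutativeRing k) _≈_ _+_ 0# -_ _·_ (flip _·_)
    ·-*-assocˡ : ∀ c x y → (c · (x * y)) ≈ ((c · x) * y)
    ·-*-assocʳ : ∀ c x y → (c · (x * y)) ≈ (x * (c · y))

record IsKAlgEmbedding {c ℓ a ℓa b ℓb} {k : Field c ℓ}
       (A : RawKAlg k a ℓa) (B : RawKAlg k b ℓb)
       (f : RawKAlg.Carrier A → RawKAlg.Carrier B) : Set (c ⊔ a ⊔ ℓa ⊔ ℓb) where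
  private
    module A = RawKAlg A
    module B = RawKAlg B
  field
    isRingMonomorphism : RingMorphisms.IsRingMonomorphism A.rawRing B.rawRing f
    ·-homo : ∀ c x → f (c A.· x) B.≈ (c B.· f x)

_^⊕_ : ∀ {c ℓ a ℓa} {k : Field c ℓ} → RawKAlg k a ℓa → ℕ → RawKAlg k a ℓa
A ^⊕ m = record
  { rawRing = record
    { Carrier = Fin m → Carrier
    ; _≈_ = λ x y → ∀ i → x i ≈ y i
    ; _+_ = λ x y i → x i + y i
    ; _*_ = λ x y i → x i * y i
    ; -_ = λ x i → - x i
    ; 0# = λ _ → 0#
    ; 1# = λ _ → 1#
    }
  ; _·_ = λ c x i → c · x i
  }
  where open RawKAlg A

module Setup {c ℓ c' ℓ'} {k : Field c ℓ} {k' : Field c' ℓ'} (E : FiniteExt k k') where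
  private
    module k = Field k
    module k' = Field k'
  open FiniteExt E

  Kt : RawRing c' ℓ'
  Kt = LSRing k'.rawRing

  Lring : RawRing c' ℓ'
  Lring = LSRing Kt

  open RawRing Lring public using ()
    renaming (Carrier to L; _≈_ to _≈L_; _+_ to _+L_; _*_ to _*L_;
              -_ to -L_; 0# to 0L; 1# to 1L)

  -- coefficient of t^i u^j
  coeffL : L → ℤ → ℤ → k'.Carrier
  coeffL f i j = coeff k'.rawRing (coeff Kt f j) i

  _·L_ : k.Carrier → L → L
  a ·L f = mapLS Kt (mapLS k'.rawRing (ι a k'.*_)) f

  _∈O_ : L → ℤ → Set ℓ'
  f ∈O n = ∀ i j → j < n → coeffL f i j k'.≈ k'.0#

  _∈W[_,_] : L → ℤ → ℤ → Set ℓ'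
  f ∈W[ l , m ] = ∀ i j → (j < m ⊎ i < l) → coeffL f i j k'.≈ k'.0#

  -- h lies in (the preimage of) the basic neighbourhood image of
  -- t^l u^m k'[[t,u]] in O_m/O_n, i.e. h ∈ t^l u^m k'[[t,u]] + O_n
  _∈W[_,_]+O_ : L → ℤ → ℤ → ℤ → Set (c' ⊔ ℓ')
  h ∈W[ l , m ]+O n = ∃[ w ] ∃[ o ] (w ∈W[ l , m ] × o ∈O n × h ≈L (w +L o))

  Maps : (L → L) → ℤ → ℤ → Set (c' ⊔ ℓ')
  Maps A n m = ∀ f → f ∈O n → A f ∈O m

  IsKLinear : (L → L) → Set (c ⊔ c' ⊔ ℓ')
  IsKLinear A = (∀ f g → f ≈L g → A f ≈L A g)
              × (∀ f g → A (f +L g) ≈L (A f +L A g))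
              × (∀ a f → A (a ·L f) ≈L (a ·L A f))

  -- continuity of the induced map O_{n1}/O_{n2} → O_{m1}/O_{m2}
  -- (at every point of the source, w.r.t. the given neighbourhood bases)
  InducedContinuous : (L → L) → ℤ → ℤ → ℤ → ℤ → Set (c' ⊔ ℓ')
  InducedContinuous A n₁ n₂ m₁ m₂ =
    ∀ f → f ∈O n₁ → ∀ l → ∃[ l' ] ∀ g → g ∈W[ l' , n₁ ]+O n₂ →
      (A (f +L g) +L (-L A f)) ∈W[ l , m₁ ]+O m₂

  IsEnd : (L → L) → Set (c ⊔ c' ⊔ ℓ')
  IsEnd A = IsKLinear A
          × (∀ n → ∃[ m ] Maps A n m)
          × (∀ m → ∃[ n ] Maps A n m)
          × (∀ n₁ n₂ m₁ m₂ → n₁ < n₂ → m₁ < m₂ → Maps A n₁ m₁ → Maps A n₂ m₂ →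
               InducedContinuous A n₁ n₂ m₁ m₂)

  EndCarrier : Set (c ⊔ c' ⊔ ℓ')
  EndCarrier = Σ (L → L) IsEnd

  record EndClosed : Set (c ⊔ c' ⊔ ℓ') where
    field
      +-closed : ∀ A B → IsEnd A → IsEnd B → IsEnd (λ f → A f +L B f)
      ∘-closed : ∀ A B → IsEnd A → IsEnd B → IsEnd (A ∘ B)
      neg-closed : ∀ A → IsEnd A → IsEnd (λ f → -L A f)
      ·-closed : ∀ a A → IsEnd A → IsEnd (λ f → a ·L A f)
      0-closed : IsEnd (λ _ → 0L)
      id-closed : IsEnd id

  EndAlg : EndClosed → RawKAlg k (c ⊔ c' ⊔ ℓ') (c' ⊔ ℓ')
  EndAlg cl = record
    { rawRing = record
      { Carrier = EndCarrier
      ; _≈_ = λ A B → ∀ f → proj₁ A f ≈L proj₁ B f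
      ; _+_ = λ A B → (λ f → proj₁ A f +L proj₁ B f) , +-closed (proj₁ A) (proj₁ B) (proj₂ A) (proj₂ B)
      ; _*_ = λ A B → (proj₁ A ∘ proj₁ B) , ∘-closed (proj₁ A) (proj₁ B) (proj₂ A) (proj₂ B)
      ; -_ = λ A → (λ f → -L proj₁ A f) , neg-closed (proj₁ A) (proj₂ A)
      ; 0# = (λ _ → 0L) , 0-closed
      ; 1# = id , id-closed
      }
    ; _·_ = λ a A → (λ f → a ·L proj₁ A f) , ·-closed a (proj₁ A) (proj₂ A)
    }
    where open EndClosed cl

  gl : ℕ → RawKAlg k c' ℓ'
  gl m = record
    { rawRing = record
      { Carrier = Fin m → Fin m → L
      ; _≈_ = λ x y → ∀ i j → x i j ≈L y i j
      ; _+_ = λ x y i j → x i j +L y i j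
      ; _*_ = λ x y i j → sumFin Lring m (λ r → x i r *L y r j)
      ; -_ = λ x i j → -L x i j
      ; 0# = λ _ _ → 0L
      ; 1# = λ i j → if does (i ≟ j) then 1L else 0L
      }
    ; _·_ = λ a x i j → a ·L x i j
    }

module Submission where

open import Level using () renaming (_⊔_ to _⊔ˡ_)
open import Function using (_∘_; id)
open import Data.Bool using (true; false; if_then_else_)
open import Data.Empty using (⊥-elim)
open import Data.Product using (Σ-syntax; ∃-syntax; _×_; _,_; proj₁; proj₂)
open import Data.Sum using (_⊎_; inj₁; inj₂; [_,_])
open import Data.Nat as ℕ using (ℕ; zero; suc; _∸_; _<_; z≤n; s≤s)
import Data.Nat.Properties as ℕP
open import Data.Nat.DivMod as ℕD using (_%_; _/_)
open import Data.Integer as ℤ using (ℤ; +_; -[1+_]; ∣_∣; _⊓_; _⊔_; +<+; +≤+; -≤+; _/ℕ_) renaming (_+_ to _+ℤ_; _-_ to _-ℤ_; _*_ to _*ℤ_; _≤_ to _≤ℤ_; _<_ to _<ℤ_; _≤?_ to _≤?ℤ_; _<?_ to _<?ℤ_)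
import Data.Integer.Properties as ℤP
import Data.Integer.DivMod as ℤD
open import Data.Integer.Tactic.RingSolver using (solve-∀)
open import Data.Fin as F using (Fin; toℕ; fromℕ<)
import Data.Fin.Properties as FP
open import Relation.Binary.PropositionalEquality as P using (_≡_; cong)
open import Relation.Binary.Bundles using (Setoid)
import Relation.Binary.Reasoning.Setoid
open import Relation.Nullary using (Dec; yes; no; does; ¬_)
open import Relation.Nullary.Decidable using (dec-true; dec-false)
open import Algebra.Bundles using (Ring; RawRing; CommutativeRing)
open import Algebra.Structures using (IsRing; IsAbelianGroup)
open import Algebra.Module.Structures using (IsModule)
open import Algebra.Module.Structures.Biased using (IsModuleFromLeft)
open import Algebra.Morphism.Structures using (module RingMorphisms)
import Algebra.Properties.Ring as RingProperties
import Algebra.Properties.AbelianGroup as AbelianGroupProperties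
import Algebra.Properties.CommutativeSemigroup as CommutativeSemigroupProperties
import Algebra.Properties.Semiring.Sum as SemiringSum

open import Defs

-- Condition (3) in the definition of End(L/k) is equivalent to continuity of each
-- A : O_n → L/O_m at 0 for the t-adic topologies, and in that form it is stable under
-- sums, composition and scalars; the algebra laws then hold pointwise.  Decimating
-- u-exponents modulo m identifies L with L^m by k-linear maps compatible with the
-- lattices O_n.  Conjugating by this identification turns m endomorphisms into a
-- block-diagonal one, and a matrix over L into its action on column vectors; the
-- latter lies in End(L/k) because multiplication by a ∈ L only involves finitely many
-- u-coefficients of a between any two lattices.

i+[j-i]≡j : ∀ i j → i +ℤ (j -ℤ i) ≡ j
i+[j-i]≡j = solve-∀

[i+j]-i≡j : ∀ i j → (i +ℤ j) -ℤ i ≡ j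
[i+j]-i≡j = solve-∀

[i+j]+1≡[i+1]+j : ∀ i j → (i +ℤ j) +ℤ + 1 ≡ (i +ℤ + 1) +ℤ j
[i+j]+1≡[i+1]+j = solve-∀

i<i+suc : ∀ i n → i <ℤ i +ℤ + suc n
i<i+suc i n = P.subst (_<ℤ i +ℤ + suc n) (ℤP.+-identityʳ i) (ℤP.+-monoʳ-< i (+<+ (s≤s z≤n)))

i+suc≡[i+1]+n : ∀ i n → i +ℤ + suc n ≡ (i +ℤ + 1) +ℤ + n
i+suc≡[i+1]+n i n = P.trans (cong (i +ℤ_) (ℤP.pos-+ 1 n)) (P.sym (ℤP.+-assoc i (+ 1) (+ n)))

i≤+∣i∣ : ∀ i → i ≤ℤ + ∣ i ∣
i≤+∣i∣ (+ n) = ℤP.≤-refl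
i≤+∣i∣ -[1+ n ] = -≤+

data Offset (v i : ℤ) : Set where
  below : i <ℤ v → Offset v i
  at    : (n : ℕ) → i ≡ v +ℤ + n → Offset v i

offset : ∀ v i → Offset v i
offset v i with v ≤?ℤ i
... | yes v≤i = at ∣ i -ℤ v ∣ (P.sym (P.trans (cong (v +ℤ_) (ℤP.0≤i⇒+∣i∣≡i (ℤP.i≤j⇒0≤j-i v≤i))) (i+[j-i]≡j v i)))
... | no v≰i = below (ℤP.≰⇒> v≰i)

if-does-yes : ∀ {a p} {A : Set a} {Q : Set p} (d : Dec Q) {x y : A} → Q → (if does d then x else y) ≡ x
if-does-yes d q = cong (λ b → if b then _ else _) (dec-true d q)

if-does-no : ∀ {a p} {A : Set a} {Q : Set p} (d : Dec Q) {x y : A} → ¬ Q → (if does d then x else y) ≡ y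
if-does-no d ¬q = cong (λ b → if b then _ else _) (dec-false d ¬q)

-- The example of interest is multiplication by ι a, lifted along k′ ⊆ k′((t)) ⊆ L by mapLS.
record IsBimoduleEndo {c ℓ} (R : Ring c ℓ) (h : Ring.Carrier R → Ring.Carrier R) : Set (c ⊔ˡ ℓ) where
  open Ring R
  field
    h-cong : ∀ {x y} → x ≈ y → h x ≈ h y
    h-0    : h 0# ≈ 0#
    h-+    : ∀ x y → h (x + y) ≈ h x + h y
    h-*ˡ   : ∀ x y → h (x * y) ≈ x * h y
    h-*ʳ   : ∀ x y → h (x * y) ≈ h x * y

module LaurentSeries {c ℓ} (R : Ring c ℓ) where
  open Ring R
  open CommutativeSemigroupProperties +-commutativeSemigroup using (interchange)
  open LS
  module ≈-Reasoning = Relation.Binary.Reasoning.Setoid setoid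

  Rx : RawRing c ℓ
  Rx = LSRing rawRing
  module Rx = RawRing Rx
  open Rx public using () renaming (_+_ to _+ₗ_; _*_ to _*ₗ_; -_ to -ₗ_; 0# to 0ₗ; 1# to 1ₗ)

  coef : LS Carrier → ℤ → Carrier
  coef = coeff rawRing

  -- A record rather than the function type ∀ i → coef f i ≈ coef g i, so that
  -- f and g can be inferred from a proof of f ≋ g.
  infix 4 _≋_
  record _≋_ (f g : LS Carrier) : Set ℓ where
    constructor mk≋
    field get : ∀ i → coef f i ≈ coef g i
  open _≋_ public

  ≋-refl : ∀ {f} → f ≋ f
  ≋-refl = mk≋ (λ i → refl)

  ≋-sym : ∀ {f g} → f ≋ g → g ≋ f
  ≋-sym f≋g = mk≋ (λ i → sym (get f≋g i))

  ≋-trans : ∀ {f g h} → f ≋ g → g ≋ h → f ≋ h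
  ≋-trans f≋g g≋h = mk≋ (λ i → trans (get f≋g i) (get g≋h i))

  ≡⇒≋ : ∀ {f g} → f ≡ g → f ≋ g
  ≡⇒≋ P.refl = ≋-refl

  ≋-setoid : Setoid c ℓ
  ≋-setoid = record { Carrier = LS Carrier ; _≈_ = _≋_ ; isEquivalence = record { refl = ≋-refl ; sym = ≋-sym ; trans = ≋-trans } }

  module ≋-Reasoning = Relation.Binary.Reasoning.Setoid ≋-setoid

  coef-below : ∀ f i → i <ℤ val f → coef f i ≡ 0#
  coef-below f i i<v = if-does-no (val f ≤?ℤ i) (ℤP.<⇒≱ i<v)

  coef-at : ∀ f n → coef f (val f +ℤ + n) ≡ co f n
  coef-at f n = P.trans (if-does-yes (val f ≤?ℤ (val f +ℤ + n)) (ℤP.i≤i+j _ (+ n)))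
                        (cong (co f ∘ ∣_∣) ([i+j]-i≡j (val f) (+ n)))

  ls-cong : ∀ {v} {F G : ℕ → Carrier} → (∀ n → F n ≈ G n) → ls v F ≋ ls v G
  ls-cong {v} {F} {G} F≈G = mk≋ coef≈
    where
    coef≈ : ∀ i → coef (ls v F) i ≈ coef (ls v G) i
    coef≈ i with offset v i
    ... | below i<v = reflexive (P.trans (coef-below (ls v F) i i<v) (P.sym (coef-below (ls v G) i i<v)))
    ... | at n P.refl = begin
      coef (ls v F) (v +ℤ + n) ≡⟨ coef-at (ls v F) n ⟩
      F n                      ≈⟨ F≈G n ⟩
      G n                      ≡⟨ P.sym (coef-at (ls v G) n) ⟩
      coef (ls v G) (v +ℤ + n) ∎
      where open ≈-Reasoning

  coef-ls-+ : ∀ v (F G : ℕ → Carrier) i → coef (ls v (λ n → F n + G n)) i ≈ coef (ls v F) i + coef (ls v G) i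
  coef-ls-+ v F G i with offset v i
  ... | below i<v = begin
    coef (ls v (λ n → F n + G n)) i ≡⟨ coef-below (ls v (λ n → F n + G n)) i i<v ⟩
    0#                              ≈⟨ sym (+-identityʳ 0#) ⟩
    0# + 0#                         ≡⟨ P.sym (P.cong₂ _+_ (coef-below (ls v F) i i<v) (coef-below (ls v G) i i<v)) ⟩
    coef (ls v F) i + coef (ls v G) i ∎
    where open ≈-Reasoning
  ... | at n P.refl = reflexive (P.trans (coef-at (ls v (λ n → F n + G n)) n)
                                         (P.sym (P.cong₂ _+_ (coef-at (ls v F) n) (coef-at (ls v G) n))))

  coef-+ : ∀ f g i → coef (f +ₗ g) i ≈ coef f i + coef g i
  coef-+ f g i with offset (val f ⊓ val g) i
  ... | below i<v = begin
    coef (f +ₗ g) i ≡⟨ coef-below (f +ₗ g) i i<v ⟩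
    0#              ≈⟨ sym (+-identityʳ 0#) ⟩
    0# + 0#         ≡⟨ P.sym (P.cong₂ _+_ (coef-below f i (ℤP.<-≤-trans i<v (ℤP.i⊓j≤i _ _)))
                                           (coef-below g i (ℤP.<-≤-trans i<v (ℤP.i⊓j≤j _ _)))) ⟩
    coef f i + coef g i ∎
    where open ≈-Reasoning
  ... | at n P.refl = reflexive (coef-at (f +ₗ g) n)

  coef-mapLS : ∀ h → h 0# ≈ 0# → ∀ f i → coef (mapLS rawRing h f) i ≈ h (coef f i)
  coef-mapLS h h0≈0 f i with offset (val f) i
  ... | below i<v = begin
    coef (mapLS rawRing h f) i ≡⟨ coef-below (mapLS rawRing h f) i i<v ⟩
    0#                         ≈⟨ sym h0≈0 ⟩
    h 0#                       ≡⟨ cong h (P.sym (coef-below f i i<v)) ⟩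
    h (coef f i)               ∎
    where open ≈-Reasoning
  ... | at n P.refl = reflexive (P.trans (coef-at (mapLS rawRing h f) n) (cong h (P.sym (coef-at f n))))

  coef-0 : ∀ i → coef 0ₗ i ≈ 0#
  coef-0 i with offset (+ 0) i
  ... | below i<0 = reflexive (coef-below 0ₗ i i<0)
  ... | at n P.refl = reflexive (coef-at 0ₗ n)

  -0≈0 : - 0# ≈ 0#
  -0≈0 = AbelianGroupProperties.ε⁻¹≈ε +-abelianGroup

  coef-neg : ∀ f i → coef (-ₗ f) i ≈ - coef f i
  coef-neg = coef-mapLS -_ -0≈0

  sum-cong : ∀ n {F G : ℕ → Carrier} → (∀ a → F a ≈ G a) → sumℕ rawRing n F ≈ sumℕ rawRing n G
  sum-cong zero F≈G = F≈G 0
  sum-cong (suc n) F≈G = +-cong (F≈G 0) (sum-cong n (F≈G ∘ suc))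

  sum-+ : ∀ n (F G : ℕ → Carrier) → sumℕ rawRing n (λ a → F a + G a) ≈ sumℕ rawRing n F + sumℕ rawRing n G
  sum-+ zero F G = refl
  sum-+ (suc n) F G = trans (+-congˡ (sum-+ n (F ∘ suc) (G ∘ suc))) (interchange _ _ _ _)

  *-distribˡ-sum : ∀ n x (F : ℕ → Carrier) → x * sumℕ rawRing n F ≈ sumℕ rawRing n (λ a → x * F a)
  *-distribˡ-sum zero x F = refl
  *-distribˡ-sum (suc n) x F = trans (distribˡ _ _ _) (+-congˡ (*-distribˡ-sum n x (F ∘ suc)))

  sum-0 : ∀ n → sumℕ rawRing n (λ _ → 0#) ≈ 0#
  sum-0 zero = refl
  sum-0 (suc n) = trans (+-identityˡ _) (sum-0 n)

  conv : (ℕ → Carrier) → (ℕ → Carrier) → ℕ → Carrier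
  conv F G n = sumℕ rawRing n (λ a → F a * G (n ∸ a))

  conv-cong : ∀ n {F F′ G G′ : ℕ → Carrier} → (∀ a → F a ≈ F′ a) → (∀ a → G a ≈ G′ a) → conv F G n ≈ conv F′ G′ n
  conv-cong n F≈F′ G≈G′ = sum-cong n (λ a → *-cong (F≈F′ a) (G≈G′ (n ∸ a)))

  conv-distribʳ : ∀ n (F G H : ℕ → Carrier) → conv (λ a → F a + G a) H n ≈ conv F H n + conv G H n
  conv-distribʳ n F G H = trans (sum-cong n (λ a → distribʳ _ _ _)) (sum-+ n _ _)

  conv-distribˡ : ∀ n (F G H : ℕ → Carrier) → conv F (λ a → G a + H a) n ≈ conv F G n + conv F H n
  conv-distribˡ n F G H = trans (sum-cong n (λ a → distribˡ _ _ _)) (sum-+ n _ _)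

  conv-*ˡ : ∀ n x (F G : ℕ → Carrier) → conv (λ a → x * F a) G n ≈ x * conv F G n
  conv-*ˡ n x F G = trans (sum-cong n (λ a → *-assoc _ _ _)) (sym (*-distribˡ-sum n x _))

  conv-zeroˡ : ∀ n (G : ℕ → Carrier) → conv (λ _ → 0#) G n ≈ 0#
  conv-zeroˡ n G = trans (sum-cong n (λ a → zeroˡ _)) (sum-0 n)

  conv-assoc : ∀ n (F G H : ℕ → Carrier) → conv (conv F G) H n ≈ conv F (conv G H) n
  conv-assoc zero F G H = *-assoc _ _ _
  conv-assoc (suc n) F G H = begin
    (F 0 * G 0) * H (suc n) + conv (λ a → conv F G (suc a)) H n
      ≈⟨ +-congˡ (conv-distribʳ n (λ a → F 0 * G (suc a)) (conv (F ∘ suc) G) H) ⟩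
    (F 0 * G 0) * H (suc n) + (conv (λ a → F 0 * G (suc a)) H n + conv (conv (F ∘ suc) G) H n)
      ≈⟨ +-congˡ (+-cong (conv-*ˡ n (F 0) (G ∘ suc) H) (conv-assoc n (F ∘ suc) G H)) ⟩
    (F 0 * G 0) * H (suc n) + (F 0 * conv (G ∘ suc) H n + conv (F ∘ suc) (conv G H) n)
      ≈⟨ sym (+-assoc _ _ _) ⟩
    ((F 0 * G 0) * H (suc n) + F 0 * conv (G ∘ suc) H n) + conv (F ∘ suc) (conv G H) n
      ≈⟨ +-congʳ (+-congʳ (*-assoc _ _ _)) ⟩
    (F 0 * (G 0 * H (suc n)) + F 0 * conv (G ∘ suc) H n) + conv (F ∘ suc) (conv G H) n
      ≈⟨ +-congʳ (sym (distribˡ _ _ _)) ⟩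
    F 0 * conv G H (suc n) + conv (F ∘ suc) (conv G H) n ∎
    where open ≈-Reasoning

  conv-identityˡ : ∀ n (G : ℕ → Carrier) → conv (co 1ₗ) G n ≈ G n
  conv-identityˡ zero G = *-identityˡ _
  conv-identityˡ (suc n) G = trans (+-cong (*-identityˡ _) (conv-zeroˡ n G)) (+-identityʳ _)

  conv-identityʳ : ∀ n (F : ℕ → Carrier) → conv F (co 1ₗ) n ≈ F n
  conv-identityʳ zero F = *-identityʳ _
  conv-identityʳ (suc n) F = trans (+-cong (zeroʳ _) (conv-identityʳ n (F ∘ suc))) (+-identityˡ _)

  shift : (ℕ → Carrier) → ℕ → Carrier
  shift F zero = 0#
  shift F (suc n) = F n

  conv-shiftˡ : ∀ n (F G : ℕ → Carrier) → conv (shift F) G n ≈ shift (conv F G) n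
  conv-shiftˡ zero F G = zeroˡ _
  conv-shiftˡ (suc n) F G = trans (+-congʳ (zeroˡ _)) (+-identityˡ _)

  conv-shiftʳ : ∀ n (F G : ℕ → Carrier) → conv F (shift G) n ≈ shift (conv F G) n
  conv-shiftʳ zero F G = zeroʳ _
  conv-shiftʳ (suc n) F G = trans (+-congˡ (conv-shiftʳ n (F ∘ suc) G)) (unfold-shift n)
    where
    unfold-shift : ∀ n → F 0 * G n + shift (conv (F ∘ suc) G) n ≈ conv F G n
    unfold-shift zero = +-identityʳ _
    unfold-shift (suc m) = refl

  ls-shift : ∀ v H → ls v (shift H) ≋ ls (v +ℤ + 1) H
  ls-shift v H = mk≋ coef≈
    where
    v<v+1 : v +ℤ + 0 <ℤ v +ℤ + 1
    v<v+1 = P.subst (_<ℤ v +ℤ + 1) (P.sym (ℤP.+-identityʳ v)) (i<i+suc v 0)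
    coef≈ : ∀ i → coef (ls v (shift H)) i ≈ coef (ls (v +ℤ + 1) H) i
    coef≈ i with offset v i
    ... | below i<v = reflexive (P.trans (coef-below (ls v (shift H)) i i<v)
                                         (P.sym (coef-below (ls (v +ℤ + 1) H) i (ℤP.<-trans i<v (i<i+suc v 0)))))
    ... | at zero P.refl = reflexive (P.trans (coef-at (ls v (shift H)) 0)
                                              (P.sym (coef-below (ls (v +ℤ + 1) H) (v +ℤ + 0) v<v+1)))
    ... | at (suc n) P.refl = reflexive (P.trans (coef-at (ls v (shift H)) (suc n))
                                                 (P.sym (P.trans (cong (coef (ls (v +ℤ + 1) H)) (i+suc≡[i+1]+n v n))
                                                                 (coef-at (ls (v +ℤ + 1) H) n))))

  VanishesBelow : LS Carrier → ℤ → Set ℓ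
  VanishesBelow f v = ∀ i → i <ℤ v → coef f i ≈ 0#

  vanishesBelow-val : ∀ f → VanishesBelow f (val f)
  vanishesBelow-val f i i<v = reflexive (coef-below f i i<v)

  vanishesBelow-mono : ∀ {f v w} → w ≤ℤ v → VanishesBelow f v → VanishesBelow f w
  vanishesBelow-mono w≤v f↓v i i<w = f↓v i (ℤP.<-≤-trans i<w w≤v)

  vanishesBelow-cong : ∀ {f g} v → f ≋ g → VanishesBelow f v → VanishesBelow g v
  vanishesBelow-cong v f≋g f↓v i i<v = trans (sym (get f≋g i)) (f↓v i i<v)

  vanishesBelow-+ : ∀ {f g v} → VanishesBelow f v → VanishesBelow g v → VanishesBelow (f +ₗ g) v
  vanishesBelow-+ {f} {g} f↓v g↓v i i<v = trans (coef-+ f g i) (trans (+-cong (f↓v i i<v) (g↓v i i<v)) (+-identityʳ _))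

  vanishesBelow-sum : ∀ n (F : ℕ → LS Carrier) v → (∀ a → a ℕ.≤ n → VanishesBelow (F a) v) →
                      VanishesBelow (sumℕ Rx n F) v
  vanishesBelow-sum zero F v F↓v = F↓v 0 z≤n
  vanishesBelow-sum (suc n) F v F↓v =
    vanishesBelow-+ {F 0} {sumℕ Rx n (F ∘ suc)} (F↓v 0 z≤n)
                    (vanishesBelow-sum n (F ∘ suc) v (λ a a≤n → F↓v (suc a) (s≤s a≤n)))

  reindex : ℤ → LS Carrier → LS Carrier
  reindex v f = ls v (λ n → coef f (v +ℤ + n))

  reindex-≋ : ∀ f v → VanishesBelow f v → f ≋ reindex v f
  reindex-≋ f v f↓v = mk≋ coef≈
    where
    coef≈ : ∀ i → coef f i ≈ coef (reindex v f) i
    coef≈ i with offset v i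
    ... | below i<v = trans (f↓v i i<v) (sym (reflexive (coef-below (reindex v f) i i<v)))
    ... | at n P.refl = sym (reflexive (coef-at (reindex v f) n))

  reindex-step : ∀ f v → VanishesBelow f (v +ℤ + 1) → ∀ n → co (reindex v f) n ≈ shift (co (reindex (v +ℤ + 1) f)) n
  reindex-step f v f↓v+1 zero = f↓v+1 (v +ℤ + 0) (P.subst (_<ℤ v +ℤ + 1) (P.sym (ℤP.+-identityʳ v)) (i<i+suc v 0))
  reindex-step f v f↓v+1 (suc n) = reflexive (cong (coef f) (i+suc≡[i+1]+n v n))

  -- The product computed from the expansions of f at x^v and g at x^w.  By
  -- mulFrom-irrelevant it does not depend on v and w as long as f and g vanish below
  -- them, which is how the product is shown to respect ≋.
  mulFrom : ℤ → ℤ → LS Carrier → LS Carrier → LS Carrier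
  mulFrom v w f g = reindex v f *ₗ reindex w g

  mulFrom-stepˡ : ∀ f g v w → VanishesBelow f (v +ℤ + 1) → mulFrom v w f g ≋ mulFrom (v +ℤ + 1) w f g
  mulFrom-stepˡ f g v w f↓v+1 = begin
    mulFrom v w f g                 ≈⟨ ls-cong (λ n → conv-cong n (reindex-step f v f↓v+1) (λ a → refl {G a})) ⟩
    ls (v +ℤ w) (conv (shift F) G)  ≈⟨ ls-cong (λ n → conv-shiftˡ n F G) ⟩
    ls (v +ℤ w) (shift (conv F G))  ≈⟨ ls-shift (v +ℤ w) (conv F G) ⟩
    ls ((v +ℤ w) +ℤ + 1) (conv F G) ≡⟨ cong (λ u → ls u (conv F G)) ([i+j]+1≡[i+1]+j v w) ⟩
    mulFrom (v +ℤ + 1) w f g        ∎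
    where
    open ≋-Reasoning
    F = co (reindex (v +ℤ + 1) f)
    G = co (reindex w g)

  mulFrom-stepʳ : ∀ f g v w → VanishesBelow g (w +ℤ + 1) → mulFrom v w f g ≋ mulFrom v (w +ℤ + 1) f g
  mulFrom-stepʳ f g v w g↓w+1 = begin
    mulFrom v w f g                 ≈⟨ ls-cong (λ n → conv-cong n (λ a → refl {F a}) (reindex-step g w g↓w+1)) ⟩
    ls (v +ℤ w) (conv F (shift G))  ≈⟨ ls-cong (λ n → conv-shiftʳ n F G) ⟩
    ls (v +ℤ w) (shift (conv F G))  ≈⟨ ls-shift (v +ℤ w) (conv F G) ⟩
    ls ((v +ℤ w) +ℤ + 1) (conv F G) ≡⟨ cong (λ u → ls u (conv F G)) (ℤP.+-assoc v w (+ 1)) ⟩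
    mulFrom v (w +ℤ + 1) f g        ∎
    where
    open ≋-Reasoning
    F = co (reindex v f)
    G = co (reindex (w +ℤ + 1) g)

  mulFrom-upˡ : ∀ d f g v v′ w → VanishesBelow f v′ → v′ ≡ v +ℤ + d → mulFrom v w f g ≋ mulFrom v′ w f g
  mulFrom-upˡ zero f g v v′ w f↓v′ v′≡v+0 =
    P.subst (λ u → mulFrom v w f g ≋ mulFrom u w f g) (P.sym (P.trans v′≡v+0 (ℤP.+-identityʳ v))) (≋-refl {mulFrom v w f g})
  mulFrom-upˡ (suc d) f g v v′ w f↓v′ v′≡v+d =
    ≋-trans (mulFrom-stepˡ f g v w (vanishesBelow-mono {f} v+1≤v′ f↓v′))
            (mulFrom-upˡ d f g (v +ℤ + 1) v′ w f↓v′ (P.trans v′≡v+d (i+suc≡[i+1]+n v d)))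
    where v+1≤v′ = P.subst ((v +ℤ + 1) ≤ℤ_) (P.sym v′≡v+d) (ℤP.+-monoʳ-≤ v (+≤+ (s≤s z≤n)))

  mulFrom-upʳ : ∀ d f g v w w′ → VanishesBelow g w′ → w′ ≡ w +ℤ + d → mulFrom v w f g ≋ mulFrom v w′ f g
  mulFrom-upʳ zero f g v w w′ g↓w′ w′≡w+0 =
    P.subst (λ u → mulFrom v w f g ≋ mulFrom v u f g) (P.sym (P.trans w′≡w+0 (ℤP.+-identityʳ w))) (≋-refl {mulFrom v w f g})
  mulFrom-upʳ (suc d) f g v w w′ g↓w′ w′≡w+d =
    ≋-trans (mulFrom-stepʳ f g v w (vanishesBelow-mono {g} w+1≤w′ g↓w′))
            (mulFrom-upʳ d f g v (w +ℤ + 1) w′ g↓w′ (P.trans w′≡w+d (i+suc≡[i+1]+n w d)))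
    where w+1≤w′ = P.subst ((w +ℤ + 1) ≤ℤ_) (P.sym w′≡w+d) (ℤP.+-monoʳ-≤ w (+≤+ (s≤s z≤n)))

  mulFrom-monoˡ : ∀ f g v v′ w → v ≤ℤ v′ → VanishesBelow f v′ → mulFrom v w f g ≋ mulFrom v′ w f g
  mulFrom-monoˡ f g v v′ w v≤v′ f↓v′ with offset v v′
  ... | below v′<v = ⊥-elim (ℤP.<⇒≱ v′<v v≤v′)
  ... | at d v′≡v+d = mulFrom-upˡ d f g v v′ w f↓v′ v′≡v+d

  mulFrom-monoʳ : ∀ f g v w w′ → w ≤ℤ w′ → VanishesBelow g w′ → mulFrom v w f g ≋ mulFrom v w′ f g
  mulFrom-monoʳ f g v w w′ w≤w′ g↓w′ with offset w w′
  ... | below w′<w = ⊥-elim (ℤP.<⇒≱ w′<w w≤w′)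
  ... | at d w′≡w+d = mulFrom-upʳ d f g v w w′ g↓w′ w′≡w+d

  mulFrom-irrelevant : ∀ f g {v v′ w w′} → VanishesBelow f v → VanishesBelow f v′ → VanishesBelow g w → VanishesBelow g w′ →
                       mulFrom v w f g ≋ mulFrom v′ w′ f g
  mulFrom-irrelevant f g {v} {v′} {w} {w′} f↓v f↓v′ g↓w g↓w′ =
    ≋-trans (≋-sym (mulFrom-monoˡ f g (v ⊓ v′) v w (ℤP.i⊓j≤i v v′) f↓v))
    (≋-trans (mulFrom-monoˡ f g (v ⊓ v′) v′ w (ℤP.i⊓j≤j v v′) f↓v′)
    (≋-trans (≋-sym (mulFrom-monoʳ f g v′ (w ⊓ w′) w (ℤP.i⊓j≤i w w′) g↓w))
             (mulFrom-monoʳ f g v′ (w ⊓ w′) w′ (ℤP.i⊓j≤j w w′) g↓w′)))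

  *≋mulFrom : ∀ f g → (f *ₗ g) ≋ mulFrom (val f) (val g) f g
  *≋mulFrom f g = ls-cong (λ n → conv-cong n (λ a → sym (reflexive (coef-at f a))) (λ a → sym (reflexive (coef-at g a))))

  mulFrom-cong : ∀ {f f′ g g′} v w → f ≋ f′ → g ≋ g′ → mulFrom v w f g ≋ mulFrom v w f′ g′
  mulFrom-cong v w f≋f′ g≋g′ = ls-cong (λ n → conv-cong n (λ a → get f≋f′ (v +ℤ + a)) (λ a → get g≋g′ (w +ℤ + a)))

  *ₗ-cong : ∀ {f f′ g g′} → f ≋ f′ → g ≋ g′ → (f *ₗ g) ≋ (f′ *ₗ g′)
  *ₗ-cong {f} {f′} {g} {g′} f≋f′ g≋g′ =
    ≋-trans (*≋mulFrom f g)
    (≋-trans (mulFrom-irrelevant f g (vanishesBelow-val f) (vanishesBelow-cong _ (≋-sym f≋f′) (vanishesBelow-val f′))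
                                     (vanishesBelow-val g) (vanishesBelow-cong _ (≋-sym g≋g′) (vanishesBelow-val g′)))
    (≋-trans (mulFrom-cong (val f′) (val g′) f≋f′ g≋g′) (≋-sym (*≋mulFrom f′ g′))))

  vanishesBelow-* : ∀ {f g v w} → VanishesBelow f v → VanishesBelow g w → VanishesBelow (f *ₗ g) (v +ℤ w)
  vanishesBelow-* {f} {g} {v} {w} f↓v g↓w =
    vanishesBelow-cong (v +ℤ w) (≋-sym (≋-trans (*≋mulFrom f g) (mulFrom-irrelevant f g (vanishesBelow-val f) f↓v (vanishesBelow-val g) g↓w)))
                       (vanishesBelow-val (mulFrom v w f g))

  +ₗ-cong : ∀ {f f′ g g′} → f ≋ f′ → g ≋ g′ → (f +ₗ g) ≋ (f′ +ₗ g′)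
  +ₗ-cong {f} {f′} {g} {g′} f≋f′ g≋g′ = mk≋ λ i →
    trans (coef-+ f g i) (trans (+-cong (get f≋f′ i) (get g≋g′ i)) (sym (coef-+ f′ g′ i)))

  +ₗ-assoc : ∀ f g h → ((f +ₗ g) +ₗ h) ≋ (f +ₗ (g +ₗ h))
  +ₗ-assoc f g h = mk≋ λ i → begin
    coef ((f +ₗ g) +ₗ h) i      ≈⟨ coef-+ (f +ₗ g) h i ⟩
    coef (f +ₗ g) i + coef h i  ≈⟨ +-congʳ (coef-+ f g i) ⟩
    (coef f i + coef g i) + coef h i ≈⟨ +-assoc _ _ _ ⟩
    coef f i + (coef g i + coef h i) ≈⟨ +-congˡ (coef-+ g h i) ⟨
    coef f i + coef (g +ₗ h) i  ≈⟨ coef-+ f (g +ₗ h) i ⟨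
    coef (f +ₗ (g +ₗ h)) i      ∎
    where open ≈-Reasoning

  +ₗ-comm : ∀ f g → (f +ₗ g) ≋ (g +ₗ f)
  +ₗ-comm f g = mk≋ λ i → trans (coef-+ f g i) (trans (+-comm _ _) (sym (coef-+ g f i)))

  +ₗ-identityˡ : ∀ f → (0ₗ +ₗ f) ≋ f
  +ₗ-identityˡ f = mk≋ λ i → trans (coef-+ 0ₗ f i) (trans (+-congʳ (coef-0 i)) (+-identityˡ _))

  +ₗ-identityʳ : ∀ f → (f +ₗ 0ₗ) ≋ f
  +ₗ-identityʳ f = mk≋ λ i → trans (coef-+ f 0ₗ i) (trans (+-congˡ (coef-0 i)) (+-identityʳ _))

  -ₗ-inverseˡ : ∀ f → (-ₗ f +ₗ f) ≋ 0ₗ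
  -ₗ-inverseˡ f = mk≋ λ i → trans (coef-+ (-ₗ f) f i) (trans (+-congʳ (coef-neg f i)) (trans (-‿inverseˡ _) (sym (coef-0 i))))

  -ₗ-inverseʳ : ∀ f → (f +ₗ -ₗ f) ≋ 0ₗ
  -ₗ-inverseʳ f = mk≋ λ i → trans (coef-+ f (-ₗ f) i) (trans (+-congˡ (coef-neg f i)) (trans (-‿inverseʳ _) (sym (coef-0 i))))

  -ₗ-cong : ∀ {f g} → f ≋ g → (-ₗ f) ≋ (-ₗ g)
  -ₗ-cong {f} {g} f≋g = mk≋ λ i → trans (coef-neg f i) (trans (-‿cong (get f≋g i)) (sym (coef-neg g i)))

  ls-val-cong : ∀ {v w} (F : ℕ → Carrier) → v ≡ w → ls v F ≋ ls w F
  ls-val-cong F P.refl = ≋-refl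

  *ₗ-assoc : ∀ f g h → ((f *ₗ g) *ₗ h) ≋ (f *ₗ (g *ₗ h))
  *ₗ-assoc f g h = ≋-trans (ls-cong (λ n → conv-assoc n (co f) (co g) (co h)))
                           (ls-val-cong _ (ℤP.+-assoc (val f) (val g) (val h)))

  *ₗ-identityˡ : ∀ f → (1ₗ *ₗ f) ≋ f
  *ₗ-identityˡ f = ≋-trans (ls-cong (λ n → conv-identityˡ n (co f))) (ls-val-cong (co f) (ℤP.+-identityˡ (val f)))

  *ₗ-identityʳ : ∀ f → (f *ₗ 1ₗ) ≋ f
  *ₗ-identityʳ f = ≋-trans (ls-cong (λ n → conv-identityʳ n (co f))) (ls-val-cong (co f) (ℤP.+-identityʳ (val f)))

  -- The proofs of distributivity re-express the sum g + h and its summands from the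
  -- common lower bound val g ⊓ val h, where the product is a coefficientwise sum.
  *ₗ-distribˡ : ∀ f g h → (f *ₗ (g +ₗ h)) ≋ ((f *ₗ g) +ₗ (f *ₗ h))
  *ₗ-distribˡ f g h = mk≋ λ i → begin
    coef (f *ₗ (g +ₗ h)) i ≈⟨ get (ls-cong (λ n → conv-distribˡ n (co f) G H)) i ⟩
    coef (ls (val f +ℤ w) (λ n → conv (co f) G n + conv (co f) H n)) i ≈⟨ coef-ls-+ _ (conv (co f) G) (conv (co f) H) i ⟩
    coef (f *ₗ reindex w g) i + coef (f *ₗ reindex w h) i
      ≈⟨ +-cong (get (*ₗ-cong (≋-refl {f}) (≋-sym (reindex-≋ g w g↓w))) i) (get (*ₗ-cong (≋-refl {f}) (≋-sym (reindex-≋ h w h↓w))) i) ⟩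
    coef (f *ₗ g) i + coef (f *ₗ h) i ≈⟨ coef-+ (f *ₗ g) (f *ₗ h) i ⟨
    coef ((f *ₗ g) +ₗ (f *ₗ h)) i ∎
    where
    open ≈-Reasoning
    w = val g ⊓ val h
    G = co (reindex w g)
    H = co (reindex w h)
    g↓w : VanishesBelow g w
    g↓w = vanishesBelow-mono {g} (ℤP.i⊓j≤i (val g) (val h)) (vanishesBelow-val g)
    h↓w : VanishesBelow h w
    h↓w = vanishesBelow-mono {h} (ℤP.i⊓j≤j (val g) (val h)) (vanishesBelow-val h)

  *ₗ-distribʳ : ∀ f g h → ((g +ₗ h) *ₗ f) ≋ ((g *ₗ f) +ₗ (h *ₗ f))
  *ₗ-distribʳ f g h = mk≋ λ i → begin
    coef ((g +ₗ h) *ₗ f) i ≈⟨ get (ls-cong (λ n → conv-distribʳ n G H (co f))) i ⟩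
    coef (ls (w +ℤ val f) (λ n → conv G (co f) n + conv H (co f) n)) i ≈⟨ coef-ls-+ _ (conv G (co f)) (conv H (co f)) i ⟩
    coef (reindex w g *ₗ f) i + coef (reindex w h *ₗ f) i
      ≈⟨ +-cong (get (*ₗ-cong (≋-sym (reindex-≋ g w g↓w)) (≋-refl {f})) i) (get (*ₗ-cong (≋-sym (reindex-≋ h w h↓w)) (≋-refl {f})) i) ⟩
    coef (g *ₗ f) i + coef (h *ₗ f) i ≈⟨ coef-+ (g *ₗ f) (h *ₗ f) i ⟨
    coef ((g *ₗ f) +ₗ (h *ₗ f)) i ∎
    where
    open ≈-Reasoning
    w = val g ⊓ val h
    G = co (reindex w g)
    H = co (reindex w h)
    g↓w : VanishesBelow g w
    g↓w = vanishesBelow-mono {g} (ℤP.i⊓j≤i (val g) (val h)) (vanishesBelow-val g)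
    h↓w : VanishesBelow h w
    h↓w = vanishesBelow-mono {h} (ℤP.i⊓j≤j (val g) (val h)) (vanishesBelow-val h)

  ring : Ring c ℓ
  ring = record
    { Carrier = LS Carrier ; _≈_ = Rx._≈_ ; _+_ = _+ₗ_ ; _*_ = _*ₗ_ ; -_ = -ₗ_ ; 0# = 0ₗ ; 1# = 1ₗ
    ; isRing = record
      { +-isAbelianGroup = record
        { isGroup = record
          { isMonoid = record
            { isSemigroup = record
              { isMagma = record
                { isEquivalence = record { refl = λ i → refl ; sym = λ e i → sym (e i) ; trans = λ e e′ i → trans (e i) (e′ i) }
                ; ∙-cong = λ {f} {f′} {g} {g′} e e′ → get (+ₗ-cong {f} {f′} {g} {g′} (mk≋ e) (mk≋ e′)) }
              ; assoc = λ f g h → get (+ₗ-assoc f g h) }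
            ; identity = (λ f → get (+ₗ-identityˡ f)) , (λ f → get (+ₗ-identityʳ f)) }
          ; inverse = (λ f → get (-ₗ-inverseˡ f)) , (λ f → get (-ₗ-inverseʳ f))
          ; ⁻¹-cong = λ {f} {g} e → get (-ₗ-cong {f} {g} (mk≋ e)) }
        ; comm = λ f g → get (+ₗ-comm f g) }
      ; *-cong = λ {f} {f′} {g} {g′} e e′ → get (*ₗ-cong {f} {f′} {g} {g′} (mk≋ e) (mk≋ e′))
      ; *-assoc = λ f g h → get (*ₗ-assoc f g h)
      ; *-identity = (λ f → get (*ₗ-identityˡ f)) , (λ f → get (*ₗ-identityʳ f))
      ; distrib = (λ f g h → get (*ₗ-distribˡ f g h)) , (λ f g h → get (*ₗ-distribʳ f g h)) } }

  private
    module ring = Ring ring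
    module ringProperties = RingProperties ring
    module +-groupProperties = AbelianGroupProperties ring.+-abelianGroup

  *ₗ-zeroˡ : ∀ f → (0ₗ *ₗ f) ≋ 0ₗ
  *ₗ-zeroˡ f = mk≋ (ring.zeroˡ f)

  *ₗ-zeroʳ : ∀ f → (f *ₗ 0ₗ) ≋ 0ₗ
  *ₗ-zeroʳ f = mk≋ (ring.zeroʳ f)

  -ₗ-0 : (-ₗ 0ₗ) ≋ 0ₗ
  -ₗ-0 = mk≋ +-groupProperties.ε⁻¹≈ε

  -ₗ-distrib-+ : ∀ f g → (-ₗ (f +ₗ g)) ≋ ((-ₗ f) +ₗ (-ₗ g))
  -ₗ-distrib-+ f g = ≋-sym (mk≋ (+-groupProperties.⁻¹-∙-comm f g))

  -ₗ-distribˡ-* : ∀ f g → (-ₗ (f *ₗ g)) ≋ ((-ₗ f) *ₗ g)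
  -ₗ-distribˡ-* f g = mk≋ (ringProperties.-‿distribˡ-* f g)

  f+f≋f⇒f≋0 : ∀ f → (f +ₗ f) ≋ f → f ≋ 0ₗ
  f+f≋f⇒f≋0 f f+f≋f = mk≋ (ringProperties.x+x≈x⇒x≈0 f (get f+f≋f))

  module _ {h : Carrier → Carrier} (isEndo : IsBimoduleEndo R h) where
    open IsBimoduleEndo isEndo

    coef-mapLS-endo : ∀ f i → coef (mapLS rawRing h f) i ≈ h (coef f i)
    coef-mapLS-endo = coef-mapLS h h-0

    h-sum : ∀ n F → h (sumℕ rawRing n F) ≈ sumℕ rawRing n (h ∘ F)
    h-sum zero F = refl
    h-sum (suc n) F = trans (h-+ _ _) (+-congˡ (h-sum n (F ∘ suc)))

    mapLS-isBimoduleEndo : IsBimoduleEndo ring (mapLS rawRing h)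
    mapLS-isBimoduleEndo = record
      { h-cong = λ {f} {g} f≈g i → trans (coef-mapLS-endo f i) (trans (h-cong (f≈g i)) (sym (coef-mapLS-endo g i)))
      ; h-0 = λ i → trans (coef-mapLS-endo 0ₗ i) (trans (h-cong (coef-0 i)) (trans h-0 (sym (coef-0 i))))
      ; h-+ = λ f g i → trans (coef-mapLS-endo (f +ₗ g) i) (trans (h-cong (coef-+ f g i)) (trans (h-+ _ _)
                           (sym (trans (coef-+ (mapLS rawRing h f) (mapLS rawRing h g) i) (+-cong (coef-mapLS-endo f i) (coef-mapLS-endo g i))))))
      ; h-*ˡ = λ f g → get (ls-cong (λ n → trans (h-sum n _) (sum-cong n (λ a → h-*ˡ (co f a) (co g (n ∸ a))))))
      ; h-*ʳ = λ f g → get (ls-cong (λ n → trans (h-sum n _) (sum-cong n (λ a → h-*ʳ (co f a) (co g (n ∸ a)))))) }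

module DoubleSeries {c ℓ c′ ℓ′} {k : Field c ℓ} {k′ : Field c′ ℓ′} (E : FiniteExt k k′) where
  open Setup E public
  open FiniteExt E
  module k = Field k
  module k′ = Field k′
  open k′ using () renaming (_≈_ to _≈′_; _+_ to _+′_; _*_ to _*′_; -_ to -′_; 0# to 0′)

  -- L = k′((t))((u)) is built in two layers: T is the layer of series in t over k′,
  -- U the layer of series in u over T.Rx = k′((t)).
  module T = LaurentSeries (CommutativeRing.ring k′.commutativeRing)
  module U = LaurentSeries T.ring
  module Kt = Ring T.ring
  module Lr = Ring U.ring

  open U using (_≋_; ≋-refl; ≋-sym; ≋-trans; mk≋; get) public

  coeffL-ext : ∀ {f g} → (∀ i j → coeffL f i j ≈′ coeffL g i j) → f ≋ g
  coeffL-ext coef≈ = mk≋ (λ j i → coef≈ i j)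

  coeffL-+ : ∀ f g i j → coeffL (f +L g) i j ≈′ (coeffL f i j +′ coeffL g i j)
  coeffL-+ f g i j = k′.trans (U.coef-+ f g j i) (T.coef-+ (U.coef f j) (U.coef g j) i)

  coeffL-neg : ∀ f i j → coeffL (-L f) i j ≈′ -′ coeffL f i j
  coeffL-neg f i j = k′.trans (U.coef-neg f j i) (T.coef-neg (U.coef f j) i)

  coeffL-0 : ∀ i j → coeffL 0L i j ≈′ 0′
  coeffL-0 i j = k′.trans (U.coef-0 j i) (T.coef-0 i)

  ι*-isBimoduleEndo : ∀ a → IsBimoduleEndo (CommutativeRing.ring k′.commutativeRing) (ι a *′_)
  ι*-isBimoduleEndo a = record
    { h-cong = k′.*-congˡ
    ; h-0 = k′.zeroʳ _
    ; h-+ = λ x y → k′.distribˡ _ _ _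
    ; h-*ˡ = λ x y → k′.trans (k′.sym (k′.*-assoc _ _ _)) (k′.trans (k′.*-congʳ (k′.*-comm _ _)) (k′.*-assoc _ _ _))
    ; h-*ʳ = λ x y → k′.sym (k′.*-assoc _ _ _) }

  ·Kt-isBimoduleEndo : ∀ a → IsBimoduleEndo T.ring (mapLS k′.rawRing (ι a *′_))
  ·Kt-isBimoduleEndo a = T.mapLS-isBimoduleEndo (ι*-isBimoduleEndo a)

  ·L-isBimoduleEndo : ∀ a → IsBimoduleEndo U.ring (a ·L_)
  ·L-isBimoduleEndo a = U.mapLS-isBimoduleEndo (·Kt-isBimoduleEndo a)

  coeffL-· : ∀ a f i j → coeffL (a ·L f) i j ≈′ (ι a *′ coeffL f i j)
  coeffL-· a f i j = k′.trans (U.coef-mapLS-endo (·Kt-isBimoduleEndo a) f j i) (T.coef-mapLS-endo (ι*-isBimoduleEndo a) (U.coef f j) i)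

  open RingMorphisms.IsRingHomomorphism ι-hom using (⟦⟧-cong; +-homo; *-homo; 1#-homo; 0#-homo)
  open IsBimoduleEndo

  ·-cong : ∀ {a b f g} → a k.≈ b → f ≋ g → (a ·L f) ≋ (b ·L g)
  ·-cong {a} {b} {f} {g} a≈b f≋g = coeffL-ext λ i j →
    k′.trans (coeffL-· a f i j) (k′.trans (k′.*-cong (⟦⟧-cong a≈b) (get f≋g j i)) (k′.sym (coeffL-· b g i j)))

  ·-distribˡ : ∀ a f g → (a ·L (f +L g)) ≋ ((a ·L f) +L (a ·L g))
  ·-distribˡ a f g = mk≋ (h-+ (·L-isBimoduleEndo a) f g)

  ·-zeroʳ : ∀ a → (a ·L 0L) ≋ 0L
  ·-zeroʳ a = mk≋ (h-0 (·L-isBimoduleEndo a))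

  ·-*ˡ : ∀ a f g → (a ·L (f *L g)) ≋ (f *L (a ·L g))
  ·-*ˡ a f g = mk≋ (h-*ˡ (·L-isBimoduleEndo a) f g)

  ·-*ʳ : ∀ a f g → (a ·L (f *L g)) ≋ ((a ·L f) *L g)
  ·-*ʳ a f g = mk≋ (h-*ʳ (·L-isBimoduleEndo a) f g)

  ·-distribʳ : ∀ a b f → ((a k.+ b) ·L f) ≋ ((a ·L f) +L (b ·L f))
  ·-distribʳ a b f = coeffL-ext λ i j →
    k′.trans (coeffL-· (a k.+ b) f i j) (k′.trans (k′.*-congʳ (+-homo a b)) (k′.trans (k′.distribʳ _ _ _)
      (k′.sym (k′.trans (coeffL-+ (a ·L f) (b ·L f) i j) (k′.+-cong (coeffL-· a f i j) (coeffL-· b f i j))))))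

  ·-assoc : ∀ a b f → ((a k.* b) ·L f) ≋ (a ·L (b ·L f))
  ·-assoc a b f = coeffL-ext λ i j →
    k′.trans (coeffL-· (a k.* b) f i j) (k′.trans (k′.*-congʳ (*-homo a b)) (k′.trans (k′.*-assoc _ _ _)
      (k′.sym (k′.trans (coeffL-· a (b ·L f) i j) (k′.*-congˡ (coeffL-· b f i j))))))

  ·-identityˡ : ∀ f → (k.1# ·L f) ≋ f
  ·-identityˡ f = coeffL-ext λ i j → k′.trans (coeffL-· k.1# f i j) (k′.trans (k′.*-congʳ 1#-homo) (k′.*-identityˡ _))

  ·-zeroˡ : ∀ f → (k.0# ·L f) ≋ 0L
  ·-zeroˡ f = coeffL-ext λ i j →
    k′.trans (coeffL-· k.0# f i j) (k′.trans (k′.*-congʳ 0#-homo) (k′.trans (k′.zeroˡ _) (k′.sym (coeffL-0 i j))))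

  ·-comm : ∀ a b f → (a ·L (b ·L f)) ≋ (b ·L (a ·L f))
  ·-comm a b f = coeffL-ext λ i j →
    k′.trans (coeffL-· a (b ·L f) i j) (k′.trans (k′.*-congˡ (coeffL-· b f i j))
      (k′.trans (k′.sym (k′.*-assoc _ _ _)) (k′.trans (k′.*-congʳ (k′.*-comm _ _)) (k′.trans (k′.*-assoc _ _ _)
        (k′.sym (k′.trans (coeffL-· b (a ·L f) i j) (k′.*-congˡ (coeffL-· a f i j))))))))

  ·-neg : ∀ a f → (a ·L (-L f)) ≋ (-L (a ·L f))
  ·-neg a f = coeffL-ext λ i j →
    k′.trans (coeffL-· a (-L f) i j) (k′.trans (k′.*-congˡ (coeffL-neg f i j)) (k′.trans (k′.sym (k′-ringProperties.-‿distribʳ-* _ _))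
      (k′.sym (k′.trans (coeffL-neg (a ·L f) i j) (k′.-‿cong (coeffL-· a f i j))))))
    where module k′-ringProperties = RingProperties (CommutativeRing.ring k′.commutativeRing)

  -- col-…: the coefficient U.coef f j ∈ k′((t)) of u^j in f ∈ L.

  col-+ : ∀ f g j → U.coef (f +L g) j T.≋ (U.coef f j Kt.+ U.coef g j)
  col-+ f g j = T.mk≋ (U.coef-+ f g j)

  col-neg : ∀ f j → U.coef (-L f) j T.≋ (Kt.- U.coef f j)
  col-neg f j = T.mk≋ (U.coef-neg f j)

  col-0 : ∀ j → U.coef 0L j T.≋ Kt.0#
  col-0 j = T.mk≋ (U.coef-0 j)

  col-· : ∀ a f j → U.coef (a ·L f) j T.≋ mapLS k′.rawRing (ι a k′.*_) (U.coef f j)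
  col-· a f j = T.mk≋ (U.coef-mapLS-endo (·Kt-isBimoduleEndo a) f j)

  col-≋ : ∀ {f g} → f ≋ g → ∀ j → U.coef f j T.≋ U.coef g j
  col-≋ f≋g j = T.mk≋ (get f≋g j)

  -- f ∈t^ l +O n: the coefficient of t^i u^j in f vanishes whenever i < l and j < n,
  -- i.e. f ∈ t^l k′[[t]]((u)) + O_n.
  _∈t^_+O_ : L → ℤ → ℤ → Set ℓ′
  f ∈t^ l +O n = ∀ i j → j <ℤ n → i <ℤ l → coeffL f i j ≈′ 0′

  vanishesBelow⇒O : ∀ g n → U.VanishesBelow g n → g ∈O n
  vanishesBelow⇒O g n g↓n i j j<n = k′.trans (g↓n j j<n i) (T.coef-0 i)

  O⇒vanishesBelow : ∀ g n → g ∈O n → U.VanishesBelow g n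
  O⇒vanishesBelow g n g∈O j j<n i = k′.trans (g∈O i j j<n) (k′.sym (T.coef-0 i))

  O-resp : ∀ {f g n} → f ≋ g → f ∈O n → g ∈O n
  O-resp f≋g f∈O i j j<n = k′.trans (k′.sym (get f≋g j i)) (f∈O i j j<n)

  O-weaken : ∀ f {n n′} → n′ ≤ℤ n → f ∈O n → f ∈O n′
  O-weaken f n′≤n f∈O i j j<n′ = f∈O i j (ℤP.<-≤-trans j<n′ n′≤n)

  O-+ : ∀ f g {n} → f ∈O n → g ∈O n → (f +L g) ∈O n
  O-+ f g f∈O g∈O i j j<n = k′.trans (coeffL-+ f g i j) (k′.trans (k′.+-cong (f∈O i j j<n) (g∈O i j j<n)) (k′.+-identityʳ _))

  O-neg : ∀ f {n} → f ∈O n → (-L f) ∈O n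
  O-neg f f∈O i j j<n = k′.trans (coeffL-neg f i j) (k′.trans (k′.-‿cong (f∈O i j j<n)) T.-0≈0)

  O-· : ∀ a f {n} → f ∈O n → (a ·L f) ∈O n
  O-· a f f∈O i j j<n = k′.trans (coeffL-· a f i j) (k′.trans (k′.*-congˡ (f∈O i j j<n)) (k′.zeroʳ _))

  O-0 : ∀ n → 0L ∈O n
  O-0 n i j _ = coeffL-0 i j

  T-resp : ∀ {f g l n} → f ≋ g → f ∈t^ l +O n → g ∈t^ l +O n
  T-resp f≋g f∈T i j j<n i<l = k′.trans (k′.sym (get f≋g j i)) (f∈T i j j<n i<l)

  T-weaken : ∀ f {l l′ n n′} → l′ ≤ℤ l → n′ ≤ℤ n → f ∈t^ l +O n → f ∈t^ l′ +O n′
  T-weaken f l′≤l n′≤n f∈T i j j<n′ i<l′ = f∈T i j (ℤP.<-≤-trans j<n′ n′≤n) (ℤP.<-≤-trans i<l′ l′≤l)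

  T-+ : ∀ f g {l n} → f ∈t^ l +O n → g ∈t^ l +O n → (f +L g) ∈t^ l +O n
  T-+ f g f∈T g∈T i j j<n i<l =
    k′.trans (coeffL-+ f g i j) (k′.trans (k′.+-cong (f∈T i j j<n i<l) (g∈T i j j<n i<l)) (k′.+-identityʳ _))

  T-neg : ∀ f {l n} → f ∈t^ l +O n → (-L f) ∈t^ l +O n
  T-neg f f∈T i j j<n i<l = k′.trans (coeffL-neg f i j) (k′.trans (k′.-‿cong (f∈T i j j<n i<l)) T.-0≈0)

  T-· : ∀ a f {l n} → f ∈t^ l +O n → (a ·L f) ∈t^ l +O n
  T-· a f f∈T i j j<n i<l = k′.trans (coeffL-· a f i j) (k′.trans (k′.*-congˡ (f∈T i j j<n i<l)) (k′.zeroʳ _))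

  T-0 : ∀ l n → 0L ∈t^ l +O n
  T-0 l n i j _ _ = coeffL-0 i j

  O⇒T : ∀ f {n} l → f ∈O n → f ∈t^ l +O n
  O⇒T f l f∈O i j j<n _ = f∈O i j j<n

  W⇒O : ∀ f {l m} → f ∈W[ l , m ] → f ∈O m
  W⇒O f f∈W i j j<m = f∈W i j (inj₁ j<m)

  W⇒T : ∀ f {l m} n → f ∈W[ l , m ] → f ∈t^ l +O n
  W⇒T f n f∈W i j _ i<l = f∈W i j (inj₂ i<l)

  W+O⇒T : ∀ h {l m n} → h ∈W[ l , m ]+O n → h ∈t^ l +O n
  W+O⇒T h (w , o , w∈W , o∈O , h≈w+o) i j j<n i<l =
    k′.trans (h≈w+o j i) (k′.trans (coeffL-+ w o i j) (k′.trans (k′.+-cong (w∈W i j (inj₂ i<l)) (o∈O i j j<n)) (k′.+-identityʳ _)))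

  open LS

  lowPart : ℤ → L → L
  lowPart n x = ls (val x) (λ r → if does ((val x +ℤ + r) <?ℤ n) then co x r else Kt.0#)

  highPart : ℤ → L → L
  highPart n x = ls (val x) (λ r → if does ((val x +ℤ + r) <?ℤ n) then Kt.0# else co x r)

  lowPart-< : ∀ n x j → j <ℤ n → U.coef (lowPart n x) j ≡ U.coef x j
  lowPart-< n x j j<n with offset (val x) j
  ... | below j<v = P.trans (U.coef-below (lowPart n x) j j<v) (P.sym (U.coef-below x j j<v))
  ... | at r P.refl = P.trans (U.coef-at (lowPart n x) r) (P.trans (if-does-yes ((val x +ℤ + r) <?ℤ n) j<n) (P.sym (U.coef-at x r)))

  lowPart-≮ : ∀ n x j → ¬ (j <ℤ n) → U.coef (lowPart n x) j ≡ Kt.0#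
  lowPart-≮ n x j j≮n with offset (val x) j
  ... | below j<v = U.coef-below (lowPart n x) j j<v
  ... | at r P.refl = P.trans (U.coef-at (lowPart n x) r) (if-does-no ((val x +ℤ + r) <?ℤ n) j≮n)

  highPart-< : ∀ n x j → j <ℤ n → U.coef (highPart n x) j ≡ Kt.0#
  highPart-< n x j j<n with offset (val x) j
  ... | below j<v = U.coef-below (highPart n x) j j<v
  ... | at r P.refl = P.trans (U.coef-at (highPart n x) r) (if-does-yes ((val x +ℤ + r) <?ℤ n) j<n)

  highPart-≮ : ∀ n x j → ¬ (j <ℤ n) → U.coef (highPart n x) j ≡ U.coef x j
  highPart-≮ n x j j≮n with offset (val x) j
  ... | below j<v = P.trans (U.coef-below (highPart n x) j j<v) (P.sym (U.coef-below x j j<v))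
  ... | at r P.refl = P.trans (U.coef-at (highPart n x) r) (P.trans (if-does-no ((val x +ℤ + r) <?ℤ n) j≮n) (P.sym (U.coef-at x r)))

  lowPart+highPart : ∀ n x → x ≋ (lowPart n x +L highPart n x)
  lowPart+highPart n x = mk≋ (λ j → T.get (coef≋ j))
    where
    coef≋ : ∀ j → U.coef x j T.≋ U.coef (lowPart n x +L highPart n x) j
    coef≋ j with j <?ℤ n
    ... | yes j<n = T.≋-sym (T.≋-trans (T.mk≋ (U.coef-+ (lowPart n x) (highPart n x) j))
                      (T.≋-trans (T.+ₗ-cong (T.≡⇒≋ (lowPart-< n x j j<n)) (T.≡⇒≋ (highPart-< n x j j<n))) (T.+ₗ-identityʳ _)))
    ... | no j≮n = T.≋-sym (T.≋-trans (T.mk≋ (U.coef-+ (lowPart n x) (highPart n x) j))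
                      (T.≋-trans (T.+ₗ-cong (T.≡⇒≋ (lowPart-≮ n x j j≮n)) (T.≡⇒≋ (highPart-≮ n x j j≮n))) (T.+ₗ-identityˡ _)))

  W+O-intro : ∀ h {l m n} → h ∈O m → h ∈t^ l +O n → h ∈W[ l , m ]+O n
  W+O-intro h {l} {m} {n} h∈O h∈T = lowPart n h , highPart n h , low∈W , high∈O , get (lowPart+highPart n h)
    where
    coeffL-≡ : ∀ {x y} i → x ≡ y → T.coef x i ≡ T.coef y i
    coeffL-≡ i = cong (λ z → T.coef z i)
    low∈W : lowPart n h ∈W[ l , m ]
    low∈W i j j<m⊎i<l with j <?ℤ n
    ... | yes j<n = k′.trans (k′.reflexive (coeffL-≡ i (lowPart-< n h j j<n))) ([ (λ j<m → h∈O i j j<m) , h∈T i j j<n ] j<m⊎i<l)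
    ... | no j≮n = k′.trans (k′.reflexive (coeffL-≡ i (lowPart-≮ n h j j≮n))) (T.coef-0 i)
    high∈O : highPart n h ∈O n
    high∈O i j j<n = k′.trans (k′.reflexive (coeffL-≡ i (highPart-< n h j j<n))) (T.coef-0 i)

module Endomorphisms {c ℓ c′ ℓ′} {k : Field c ℓ} {k′ : Field c′ ℓ′} (E : FiniteExt k k′) where
  open DoubleSeries E

  module KLinear {A : L → L} (lin : IsKLinear A) where
    A-cong : ∀ {f g} → f ≋ g → A f ≋ A g
    A-cong f≋g = mk≋ (proj₁ lin _ _ (get f≋g))

    A-+ : ∀ f g → A (f +L g) ≋ (A f +L A g)
    A-+ f g = mk≋ (proj₁ (proj₂ lin) f g)

    A-· : ∀ a f → A (a ·L f) ≋ (a ·L A f)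
    A-· a f = mk≋ (proj₂ (proj₂ lin) a f)

    A-0 : A 0L ≋ 0L
    A-0 = U.f+f≋f⇒f≋0 (A 0L) (≋-trans (≋-sym (A-+ 0L 0L)) (A-cong (U.+ₗ-identityˡ 0L)))

  kLinear : ∀ {A : L → L} → (∀ {f g} → f ≋ g → A f ≋ A g) → (∀ f g → A (f +L g) ≋ (A f +L A g)) →
            (∀ a f → A (a ·L f) ≋ (a ·L A f)) → IsKLinear A
  kLinear A-cong A-+ A-· = (λ f g f≈g → get (A-cong {f} {g} (mk≋ f≈g))) , (λ f g → get (A-+ f g)) , (λ a f → get (A-· a f))

  -- Continuity of A : O_n → L/O_m at 0 for the t-adic topologies; since A is additive
  -- this is continuity everywhere, and it is what condition (3) of End(L/k) amounts to.
  Continuous : (L → L) → Set (c′ ⊔ˡ ℓ′)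
  Continuous A = ∀ n m l → ∃[ n′ ] ∃[ l′ ] (∀ g → g ∈O n → g ∈t^ l′ +O n′ → A g ∈t^ l +O m)

  record IsEnd′ (A : L → L) : Set (c ⊔ˡ c′ ⊔ˡ ℓ′) where
    field
      linear     : IsKLinear A
      mapsFrom   : ∀ n → ∃[ m ] Maps A n m
      mapsInto   : ∀ m → ∃[ n ] Maps A n m
      continuous : Continuous A
  open IsEnd′

  [f+g]-f≋g : ∀ f g → ((f +L g) +L (-L f)) ≋ g
  [f+g]-f≋g f g = begin
    (f +L g) +L (-L f) ≈⟨ U.+ₗ-cong (U.+ₗ-comm f g) (≋-refl { -L f}) ⟩
    (g +L f) +L (-L f) ≈⟨ U.+ₗ-assoc g f (-L f) ⟩
    g +L (f +L (-L f)) ≈⟨ U.+ₗ-cong (≋-refl {g}) (U.-ₗ-inverseʳ f) ⟩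
    g +L 0L            ≈⟨ U.+ₗ-identityʳ g ⟩
    g                  ∎
    where open U.≋-Reasoning

  -- Condition (3) applied at f = 0 to lattices n < n′ and m₀ < m provided by (1) and (2).
  IsEnd⇒IsEnd′ : ∀ A → IsEnd A → IsEnd′ A
  IsEnd⇒IsEnd′ A (lin , from , into , induced) = record
    { linear = lin ; mapsFrom = from ; mapsInto = into ; continuous = cont }
    where
    open KLinear {A} lin
    cont : Continuous A
    cont n m l = n′ , proj₁ ind , A-cont
      where
      m₀ = proj₁ (from n) ⊓ ℤ.pred m
      n′ = proj₁ (into m) ⊔ (n +ℤ + 1)
      A:n→m₀ : Maps A n m₀
      A:n→m₀ f f∈O = O-weaken (A f) (ℤP.i⊓j≤i _ _) (proj₂ (from n) f f∈O)
      A:n′→m : Maps A n′ m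
      A:n′→m f f∈O = proj₂ (into m) f (O-weaken f (ℤP.i≤i⊔j _ _) f∈O)
      n<n′ : n <ℤ n′
      n<n′ = ℤP.<-≤-trans (i<i+suc n 0) (ℤP.i≤j⊔i _ _)
      m₀<m : m₀ <ℤ m
      m₀<m = ℤP.i≤pred[j]⇒i<j (ℤP.i⊓j≤j _ _)
      ind = induced n n′ m₀ m n<n′ m₀<m A:n→m₀ A:n′→m 0L (O-0 n) l
      A[0+g]-A0≋Ag : ∀ g → (A (0L +L g) +L (-L A 0L)) ≋ A g
      A[0+g]-A0≋Ag g = ≋-trans (U.+ₗ-cong (A-cong (U.+ₗ-identityˡ g)) (≋-trans (U.-ₗ-cong A-0) U.-ₗ-0)) (U.+ₗ-identityʳ (A g))
      A-cont : ∀ g → g ∈O n → g ∈t^ proj₁ ind +O n′ → A g ∈t^ l +O m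
      A-cont g g∈O g∈T = T-resp (A[0+g]-A0≋Ag g) (W+O⇒T (A (0L +L g) +L (-L A 0L)) (proj₂ ind g (W+O-intro g g∈O g∈T)))

  -- A (f + g) - A f ≋ A g, and for g = w + o the term A w is small by continuity
  -- while A o ∈ O_m₂.
  IsEnd′⇒IsEnd : ∀ A → IsEnd′ A → IsEnd A
  IsEnd′⇒IsEnd A A-end = linear A-end , mapsFrom A-end , mapsInto A-end , induced
    where
    open KLinear {A} (linear A-end)
    induced : ∀ n₁ n₂ m₁ m₂ → n₁ <ℤ n₂ → m₁ <ℤ m₂ → Maps A n₁ m₁ → Maps A n₂ m₂ → InducedContinuous A n₁ n₂ m₁ m₂
    induced n₁ n₂ m₁ m₂ n₁<n₂ _ A:n₁→m₁ A:n₂→m₂ f _ l = l′ , A-cont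
      where
      n′ = proj₁ (continuous A-end n₁ m₂ l)
      l′ = proj₁ (proj₂ (continuous A-end n₁ m₂ l))
      A-small = proj₂ (proj₂ (continuous A-end n₁ m₂ l))
      A-cont : ∀ g → g ∈W[ l′ , n₁ ]+O n₂ → (A (f +L g) +L (-L A f)) ∈W[ l , m₁ ]+O m₂
      A-cont g (w , o , w∈W , o∈O , g≈w+o) = W+O-intro (A (f +L g) +L (-L A f)) ΔA∈O ΔA∈T
        where
        g≋w+o : g ≋ (w +L o)
        g≋w+o = mk≋ g≈w+o
        ΔA≋Ag : (A (f +L g) +L (-L A f)) ≋ A g
        ΔA≋Ag = ≋-trans (U.+ₗ-cong (A-+ f g) (≋-refl { -L A f})) ([f+g]-f≋g (A f) (A g))
        g∈O : g ∈O n₁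
        g∈O = O-resp (≋-sym g≋w+o) (O-+ w o (W⇒O w w∈W) (O-weaken o (ℤP.<⇒≤ n₁<n₂) o∈O))
        ΔA∈O : (A (f +L g) +L (-L A f)) ∈O m₁
        ΔA∈O = O-resp (≋-sym ΔA≋Ag) (A:n₁→m₁ g g∈O)
        ΔA∈T : (A (f +L g) +L (-L A f)) ∈t^ l +O m₂
        ΔA∈T = T-resp (≋-sym (≋-trans ΔA≋Ag (≋-trans (A-cong g≋w+o) (A-+ w o))))
                      (T-+ (A w) (A o) (A-small w (W⇒O w w∈W) (W⇒T w n′ w∈W)) (O⇒T (A o) l (A:n₂→m₂ o o∈O)))

  IsEnd′-id : IsEnd′ id
  IsEnd′-id = record
    { linear = kLinear (λ f≋g → f≋g) (λ f g → ≋-refl) (λ a f → ≋-refl)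
    ; mapsFrom = λ n → n , λ f f∈O → f∈O
    ; mapsInto = λ m → m , λ f f∈O → f∈O
    ; continuous = λ n m l → m , l , λ g _ g∈T → g∈T }

  IsEnd′-0 : IsEnd′ (λ _ → 0L)
  IsEnd′-0 = record
    { linear = kLinear (λ _ → ≋-refl) (λ f g → ≋-sym (U.+ₗ-identityˡ 0L)) (λ a f → ≋-sym (·-zeroʳ a))
    ; mapsFrom = λ n → n , λ _ _ → O-0 n
    ; mapsInto = λ m → m , λ _ _ → O-0 m
    ; continuous = λ n m l → m , l , λ _ _ _ → T-0 l m }

  IsEnd′-+ : ∀ {A B} → IsEnd′ A → IsEnd′ B → IsEnd′ (λ f → A f +L B f)
  IsEnd′-+ {A} {B} A-end B-end = record
    { linear = kLinear (λ f≋g → U.+ₗ-cong (A.A-cong f≋g) (B.A-cong f≋g))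
                       (λ f g → ≋-trans (U.+ₗ-cong (A.A-+ f g) (B.A-+ f g)) (+L-interchange (A f) (A g) (B f) (B g)))
                       (λ a f → ≋-trans (U.+ₗ-cong (A.A-· a f) (B.A-· a f)) (≋-sym (·-distribˡ a (A f) (B f))))
    ; mapsFrom = λ n → let (mA , A:n→mA) = mapsFrom A-end n ; (mB , B:n→mB) = mapsFrom B-end n in
        mA ⊓ mB , λ f f∈O → O-+ (A f) (B f) (O-weaken (A f) (ℤP.i⊓j≤i mA mB) (A:n→mA f f∈O))
                                            (O-weaken (B f) (ℤP.i⊓j≤j mA mB) (B:n→mB f f∈O))
    ; mapsInto = λ m → let (nA , A:nA→m) = mapsInto A-end m ; (nB , B:nB→m) = mapsInto B-end m in
        nA ⊔ nB , λ f f∈O → O-+ (A f) (B f) (A:nA→m f (O-weaken f (ℤP.i≤i⊔j nA nB) f∈O))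
                                            (B:nB→m f (O-weaken f (ℤP.i≤j⊔i nA nB) f∈O))
    ; continuous = λ n m l → let (nA , lA , A-cont) = continuous A-end n m l ; (nB , lB , B-cont) = continuous B-end n m l in
        nA ⊔ nB , lA ⊔ lB , λ g g∈O g∈T → T-+ (A g) (B g)
          (A-cont g g∈O (T-weaken g (ℤP.i≤i⊔j lA lB) (ℤP.i≤i⊔j nA nB) g∈T))
          (B-cont g g∈O (T-weaken g (ℤP.i≤j⊔i lA lB) (ℤP.i≤j⊔i nA nB) g∈T)) }
    where
    module A = KLinear {A} (linear A-end)
    module B = KLinear {B} (linear B-end)
    +L-interchange : ∀ a b c d → ((a +L b) +L (c +L d)) ≋ ((a +L c) +L (b +L d))
    +L-interchange a b c d = mk≋ (CommutativeSemigroupProperties.interchange Lr.+-commutativeSemigroup a b c d)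

  IsEnd′-neg : ∀ {A} → IsEnd′ A → IsEnd′ (λ f → -L A f)
  IsEnd′-neg {A} A-end = record
    { linear = kLinear (λ f≋g → U.-ₗ-cong (A.A-cong f≋g))
                       (λ f g → ≋-trans (U.-ₗ-cong (A.A-+ f g)) (U.-ₗ-distrib-+ (A f) (A g)))
                       (λ a f → ≋-trans (U.-ₗ-cong (A.A-· a f)) (≋-sym (·-neg a (A f))))
    ; mapsFrom = λ n → let (m , A:n→m) = mapsFrom A-end n in m , λ f f∈O → O-neg (A f) (A:n→m f f∈O)
    ; mapsInto = λ m → let (n , A:n→m) = mapsInto A-end m in n , λ f f∈O → O-neg (A f) (A:n→m f f∈O)
    ; continuous = λ n m l → let (n′ , l′ , A-cont) = continuous A-end n m l in
        n′ , l′ , λ g g∈O g∈T → T-neg (A g) (A-cont g g∈O g∈T) }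
    where module A = KLinear {A} (linear A-end)

  IsEnd′-· : ∀ a {A} → IsEnd′ A → IsEnd′ (λ f → a ·L A f)
  IsEnd′-· a {A} A-end = record
    { linear = kLinear (λ f≋g → ·-cong k.refl (A.A-cong f≋g))
                       (λ f g → ≋-trans (·-cong k.refl (A.A-+ f g)) (·-distribˡ a (A f) (A g)))
                       (λ b f → ≋-trans (·-cong k.refl (A.A-· b f)) (·-comm a b (A f)))
    ; mapsFrom = λ n → let (m , A:n→m) = mapsFrom A-end n in m , λ f f∈O → O-· a (A f) (A:n→m f f∈O)
    ; mapsInto = λ m → let (n , A:n→m) = mapsInto A-end m in n , λ f f∈O → O-· a (A f) (A:n→m f f∈O)
    ; continuous = λ n m l → let (n′ , l′ , A-cont) = continuous A-end n m l in
        n′ , l′ , λ g g∈O g∈T → T-· a (A g) (A-cont g g∈O g∈T) }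
    where module A = KLinear {A} (linear A-end)

  IsEnd′-∘ : ∀ {A B} → IsEnd′ A → IsEnd′ B → IsEnd′ (A ∘ B)
  IsEnd′-∘ {A} {B} A-end B-end = record
    { linear = kLinear (λ f≋g → A.A-cong (B.A-cong f≋g))
                       (λ f g → ≋-trans (A.A-cong (B.A-+ f g)) (A.A-+ (B f) (B g)))
                       (λ a f → ≋-trans (A.A-cong (B.A-· a f)) (A.A-· a (B f)))
    ; mapsFrom = λ n → let (m , B:n→m) = mapsFrom B-end n ; (m′ , A:m→m′) = mapsFrom A-end m in
        m′ , λ f f∈O → A:m→m′ (B f) (B:n→m f f∈O)
    ; mapsInto = λ m → let (n , A:n→m) = mapsInto A-end m ; (n′ , B:n′→n) = mapsInto B-end n in
        n′ , λ f f∈O → A:n→m (B f) (B:n′→n f f∈O)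
    ; continuous = λ n m l →
        let (mB , B:n→mB) = mapsFrom B-end n
            (nA , lA , A-cont) = continuous A-end mB m l
            (nB , lB , B-cont) = continuous B-end n nA lA
        in nB , lB , λ g g∈O g∈T → A-cont (B g) (B:n→mB g g∈O) (B-cont g g∈O g∈T) }
    where
    module A = KLinear {A} (linear A-end)
    module B = KLinear {B} (linear B-end)

  IsEnd′-resp : ∀ {A B} → IsEnd′ A → (∀ f → B f ≋ A f) → IsEnd′ B
  IsEnd′-resp {A} {B} A-end B≋A = record
    { linear = kLinear (λ {f} {g} f≋g → ≋-trans (B≋A f) (≋-trans (A.A-cong f≋g) (≋-sym (B≋A g))))
                       (λ f g → ≋-trans (B≋A (f +L g)) (≋-trans (A.A-+ f g) (≋-sym (U.+ₗ-cong (B≋A f) (B≋A g)))))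
                       (λ a f → ≋-trans (B≋A (a ·L f)) (≋-trans (A.A-· a f) (≋-sym (·-cong k.refl (B≋A f)))))
    ; mapsFrom = λ n → let (m , A:n→m) = mapsFrom A-end n in m , λ f f∈O → O-resp (≋-sym (B≋A f)) (A:n→m f f∈O)
    ; mapsInto = λ m → let (n , A:n→m) = mapsInto A-end m in n , λ f f∈O → O-resp (≋-sym (B≋A f)) (A:n→m f f∈O)
    ; continuous = λ n m l → let (n′ , l′ , A-cont) = continuous A-end n m l in
        n′ , l′ , λ g g∈O g∈T → T-resp (≋-sym (B≋A g)) (A-cont g g∈O g∈T) }
    where module A = KLinear {A} (linear A-end)

module EndAlgebra {c ℓ c′ ℓ′} {k : Field c ℓ} {k′ : Field c′ ℓ′} (E : FiniteExt k k′) where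
  open DoubleSeries E
  open Endomorphisms E

  endClosed : EndClosed
  endClosed = record
    { +-closed = λ A B A-end B-end → IsEnd′⇒IsEnd _ (IsEnd′-+ {A} {B} (IsEnd⇒IsEnd′ A A-end) (IsEnd⇒IsEnd′ B B-end))
    ; ∘-closed = λ A B A-end B-end → IsEnd′⇒IsEnd _ (IsEnd′-∘ {A} {B} (IsEnd⇒IsEnd′ A A-end) (IsEnd⇒IsEnd′ B B-end))
    ; neg-closed = λ A A-end → IsEnd′⇒IsEnd _ (IsEnd′-neg {A} (IsEnd⇒IsEnd′ A A-end))
    ; ·-closed = λ a A A-end → IsEnd′⇒IsEnd _ (IsEnd′-· a {A} (IsEnd⇒IsEnd′ A A-end))
    ; 0-closed = IsEnd′⇒IsEnd _ IsEnd′-0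
    ; id-closed = IsEnd′⇒IsEnd _ IsEnd′-id }

  End : RawKAlg k (c ⊔ˡ c′ ⊔ˡ ℓ′) (c′ ⊔ˡ ℓ′)
  End = EndAlg endClosed
  module End = RawKAlg End

  ≈ᴱ-intro : ∀ {X Y : EndCarrier} → (∀ f → proj₁ X f ≋ proj₁ Y f) → X End.≈ Y
  ≈ᴱ-intro X≋Y f = get (X≋Y f)

  ≈ᴱ-elim : ∀ {X Y : EndCarrier} → X End.≈ Y → ∀ f → proj₁ X f ≋ proj₁ Y f
  ≈ᴱ-elim X≈Y f = mk≋ (X≈Y f)

  module _ (X : EndCarrier) where
    open KLinear {proj₁ X} (proj₁ (proj₂ X)) public using () renaming (A-cong to End-cong; A-+ to End-+; A-· to End-·)

  End-isRing : IsRing End._≈_ End._+_ End._*_ End.-_ End.0# End.1#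
  End-isRing = record
    { +-isAbelianGroup = record
      { isGroup = record
        { isMonoid = record
          { isSemigroup = record
            { isMagma = record
              { isEquivalence = record
                { refl = λ {X} → ≈ᴱ-intro {X} {X} (λ f → ≋-refl)
                ; sym = λ {X} {Y} X≈Y → ≈ᴱ-intro {Y} {X} (λ f → ≋-sym (≈ᴱ-elim {X} {Y} X≈Y f))
                ; trans = λ {X} {Y} {Z} X≈Y Y≈Z → ≈ᴱ-intro {X} {Z} (λ f → ≋-trans (≈ᴱ-elim {X} {Y} X≈Y f) (≈ᴱ-elim {Y} {Z} Y≈Z f)) }
              ; ∙-cong = λ {X} {Y} {Z} {W} X≈Y Z≈W → ≈ᴱ-intro {X End.+ Z} {Y End.+ W} (λ f →
                  U.+ₗ-cong {proj₁ X f} {proj₁ Y f} {proj₁ Z f} {proj₁ W f} (≈ᴱ-elim {X} {Y} X≈Y f) (≈ᴱ-elim {Z} {W} Z≈W f)) }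
            ; assoc = λ X Y Z → ≈ᴱ-intro {(X End.+ Y) End.+ Z} {X End.+ (Y End.+ Z)} (λ f → U.+ₗ-assoc (proj₁ X f) (proj₁ Y f) (proj₁ Z f)) }
          ; identity = (λ X → ≈ᴱ-intro {End.0# End.+ X} {X} (λ f → U.+ₗ-identityˡ (proj₁ X f)))
                     , (λ X → ≈ᴱ-intro {X End.+ End.0#} {X} (λ f → U.+ₗ-identityʳ (proj₁ X f))) }
        ; inverse = (λ X → ≈ᴱ-intro {End.- X End.+ X} {End.0#} (λ f → U.-ₗ-inverseˡ (proj₁ X f)))
                  , (λ X → ≈ᴱ-intro {X End.+ End.- X} {End.0#} (λ f → U.-ₗ-inverseʳ (proj₁ X f)))
        ; ⁻¹-cong = λ {X} {Y} X≈Y → ≈ᴱ-intro {End.- X} {End.- Y} (λ f → U.-ₗ-cong {proj₁ X f} {proj₁ Y f} (≈ᴱ-elim {X} {Y} X≈Y f)) }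
      ; comm = λ X Y → ≈ᴱ-intro {X End.+ Y} {Y End.+ X} (λ f → U.+ₗ-comm (proj₁ X f) (proj₁ Y f)) }
    ; *-cong = λ {X} {Y} {Z} {W} X≈Y Z≈W → ≈ᴱ-intro {X End.* Z} {Y End.* W} (λ f →
        ≋-trans (End-cong X {proj₁ Z f} {proj₁ W f} (≈ᴱ-elim {Z} {W} Z≈W f)) (≈ᴱ-elim {X} {Y} X≈Y (proj₁ W f)))
    ; *-assoc = λ X Y Z → ≈ᴱ-intro {(X End.* Y) End.* Z} {X End.* (Y End.* Z)} (λ f → ≋-refl)
    ; *-identity = (λ X → ≈ᴱ-intro {End.1# End.* X} {X} (λ f → ≋-refl)) , (λ X → ≈ᴱ-intro {X End.* End.1#} {X} (λ f → ≋-refl))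
    ; distrib = (λ X Y Z → ≈ᴱ-intro {X End.* (Y End.+ Z)} {(X End.* Y) End.+ (X End.* Z)} (λ f → End-+ X (proj₁ Y f) (proj₁ Z f)))
              , (λ X Y Z → ≈ᴱ-intro {(Y End.+ Z) End.* X} {(Y End.* X) End.+ (Z End.* X)} (λ f → ≋-refl)) }

  End-isModule : IsModule k.commutativeRing End._≈_ End._+_ End.0# End.-_ End._·_ (λ X a → a End.· X)
  End-isModule = IsModuleFromLeft.isModule {commutativeRing = k.commutativeRing} (record
    { isLeftModule = record
      { isLeftSemimodule = record
        { +ᴹ-isCommutativeMonoid = IsAbelianGroup.isCommutativeMonoid (IsRing.+-isAbelianGroup End-isRing)
        ; isPreleftSemimodule = record
          { *ₗ-cong = λ {a} {b} {X} {Y} a≈b X≈Y → ≈ᴱ-intro {a End.· X} {b End.· Y} (λ f → ·-cong {a} {b} {proj₁ X f} {proj₁ Y f} a≈b (≈ᴱ-elim {X} {Y} X≈Y f))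
          ; *ₗ-zeroˡ = λ X → ≈ᴱ-intro {k.0# End.· X} {End.0#} (λ f → ·-zeroˡ (proj₁ X f))
          ; *ₗ-distribʳ = λ X a b → ≈ᴱ-intro {(a k.+ b) End.· X} {(a End.· X) End.+ (b End.· X)} (λ f → ·-distribʳ a b (proj₁ X f))
          ; *ₗ-identityˡ = λ X → ≈ᴱ-intro {k.1# End.· X} {X} (λ f → ·-identityˡ (proj₁ X f))
          ; *ₗ-assoc = λ a b X → ≈ᴱ-intro {(a k.* b) End.· X} {a End.· (b End.· X)} (λ f → ·-assoc a b (proj₁ X f))
          ; *ₗ-zeroʳ = λ a → ≈ᴱ-intro {a End.· End.0#} {End.0#} (λ f → ·-zeroʳ a)
          ; *ₗ-distribˡ = λ a X Y → ≈ᴱ-intro {a End.· (X End.+ Y)} {(a End.· X) End.+ (a End.· Y)} (λ f → ·-distribˡ a (proj₁ X f) (proj₁ Y f)) } }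
      ; -ᴹ‿cong = λ {X} {Y} → IsAbelianGroup.⁻¹-cong (IsRing.+-isAbelianGroup End-isRing) {X} {Y}
      ; -ᴹ‿inverse = IsAbelianGroup.inverse (IsRing.+-isAbelianGroup End-isRing) } })

  End-isKAlgebra : IsKAlgebra End
  End-isKAlgebra = record
    { isRing = End-isRing
    ; isModule = End-isModule
    ; ·-*-assocˡ = λ a X Y → ≈ᴱ-intro {a End.· (X End.* Y)} {(a End.· X) End.* Y} (λ f → ≋-refl)
    ; ·-*-assocʳ = λ a X Y → ≈ᴱ-intro {a End.· (X End.* Y)} {X End.* (a End.· Y)} (λ f → ≋-sym (End-· X a (proj₁ Y f))) }

module FiniteSums {c ℓ} (R : Ring c ℓ) where
  open Ring R
  open SemiringSum semiring public using (sum; sum-cong-≋; ∑-distrib-+; ∑-comm; *-distribˡ-sum; *-distribʳ-sum; sum-replicate-zero)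
  private module +-groupProperties = AbelianGroupProperties +-abelianGroup

  sumFin≡sum : ∀ n (f : Fin n → Carrier) → sumFin rawRing n f ≡ sum f
  sumFin≡sum zero f = P.refl
  sumFin≡sum (suc n) f = cong (λ x → f F.zero + x) (sumFin≡sum n (f ∘ F.suc))

  sum-neg : ∀ {n} (f : Fin n → Carrier) → sum (λ i → - f i) ≈ - sum f
  sum-neg {zero} f = sym +-groupProperties.ε⁻¹≈ε
  sum-neg {suc n} f = trans (+-congˡ (sum-neg (f ∘ F.suc))) (+-groupProperties.⁻¹-∙-comm _ _)

  sum-δ : ∀ {n} (s : Fin n) (f : Fin n → Carrier) → sum (λ r → if does (s F.≟ r) then f r else 0#) ≈ f s
  sum-δ {suc n} F.zero f = trans (+-congˡ (sum-replicate-zero n)) (+-identityʳ _)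
  sum-δ {suc n} (F.suc s) f = trans (+-identityˡ _) (trans (sum-cong-≋ λ r → reflexive (cong (λ b → if b then f (F.suc r) else 0#) (does-suc s r)))
                                                             (sum-δ s (f ∘ F.suc)))
    where
    does-suc : ∀ {n} (s r : Fin n) → does (F.suc s F.≟ F.suc r) ≡ does (s F.≟ r)
    does-suc s r with s F.≟ r
    ... | yes _ = P.refl
    ... | no _ = P.refl

  sum-δ′ : ∀ {n} (s : Fin n) (f : Fin n → Carrier) → sum (λ r → if does (r F.≟ s) then f r else 0#) ≈ f s
  sum-δ′ s f = trans (sum-cong-≋ λ r → reflexive (cong (λ b → if b then f r else 0#) (does-≟-sym r s))) (sum-δ s f)
    where
    does-≟-sym : ∀ {n} (r s : Fin n) → does (r F.≟ s) ≡ does (s F.≟ r)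
    does-≟-sym r s with r F.≟ s | s F.≟ r
    ... | yes _ | yes _ = P.refl
    ... | no _ | no _ = P.refl
    ... | yes r≡s | no s≢r = ⊥-elim (s≢r (P.sym r≡s))
    ... | no r≢s | yes s≡r = ⊥-elim (r≢s (P.sym s≡r))

minᶠ : ∀ {n} → (Fin (suc n) → ℤ) → ℤ
minᶠ {zero} v = v F.zero
minᶠ {suc n} v = v F.zero ⊓ minᶠ (v ∘ F.suc)

minᶠ≤ : ∀ {n} (v : Fin (suc n) → ℤ) r → minᶠ v ≤ℤ v r
minᶠ≤ {zero} v F.zero = ℤP.≤-refl
minᶠ≤ {suc n} v F.zero = ℤP.i⊓j≤i _ _
minᶠ≤ {suc n} v (F.suc r) = ℤP.≤-trans (ℤP.i⊓j≤j _ _) (minᶠ≤ (v ∘ F.suc) r)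

-- Positions in ℤ are written as s + j M with s : Fin M; the decimation of a series
-- in u into its M components along the residues of the u-exponents mod M identifies
-- L with L^M, as k′((t))((u)) = ⊕_{s < M} u^s k′((t))((u^M)) and k′((t))((u^M)) ≅ L.
module Residues (m′ : ℕ) where
  M : ℕ
  M = suc m′

  Mℤ : ℤ
  Mℤ = + M

  idx : ℤ → Fin M → ℤ
  idx j s = + toℕ s +ℤ j *ℤ Mℤ

  idx-< : ∀ j w s → j <ℤ w → idx j s <ℤ w *ℤ Mℤ
  idx-< j w s j<w = ℤP.<-≤-trans (ℤP.+-monoˡ-< (j *ℤ Mℤ) (+<+ (FP.toℕ<n s)))
                      (P.subst (_≤ℤ w *ℤ Mℤ) (P.sym (i+j*i≡[1+j]*i Mℤ j)) (ℤP.*-monoʳ-≤-nonNeg Mℤ (ℤP.i<j⇒suc[i]≤j j<w)))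
    where
    i+j*i≡[1+j]*i : ∀ i j → i +ℤ j *ℤ i ≡ (+ 1 +ℤ j) *ℤ i
    i+j*i≡[1+j]*i = solve-∀

  idx-≥ : ∀ j w s → w ≤ℤ j → w *ℤ Mℤ ≤ℤ idx j s
  idx-≥ j w s w≤j = ℤP.≤-trans (ℤP.*-monoʳ-≤-nonNeg Mℤ w≤j) (ℤP.i≤j⇒i≤k+j (+ toℕ s) ℤP.≤-refl)

  idx-<⁻¹ : ∀ j q s → idx j s <ℤ q *ℤ Mℤ → j <ℤ q
  idx-<⁻¹ j q s idx<qM with j <?ℤ q
  ... | yes j<q = j<q
  ... | no j≮q = ⊥-elim (ℤP.<⇒≱ idx<qM (idx-≥ j q s (ℤP.≮⇒≥ j≮q)))

  residue : ℤ → Fin M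
  residue i = fromℕ< (ℤD.n%ℕd<d i M)

  idx-quotient-residue : ∀ i → i ≡ idx (i /ℕ M) (residue i)
  idx-quotient-residue i = P.trans (ℤD.a≡a%ℕn+[a/ℕn]*n i M)
                                   (cong (λ r → + r +ℤ (i /ℕ M) *ℤ Mℤ) (P.sym (FP.toℕ-fromℕ< (ℤD.n%ℕd<d i M))))

  ∀-idx : ∀ {a} {Q : ℤ → Set a} → (∀ j s → Q (idx j s)) → ∀ i → Q i
  ∀-idx {Q = Q} Q-idx i = P.subst Q (P.sym (idx-quotient-residue i)) (Q-idx (i /ℕ M) (residue i))

  idx-+ : ∀ w n s → idx (w +ℤ + n) s ≡ w *ℤ Mℤ +ℤ + (toℕ s ℕ.+ n ℕ.* M)
  idx-+ w n s = P.trans (s+[w+n]*M≡w*M+[s+n*M] (+ toℕ s) w (+ n) Mℤ)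
                        (cong (w *ℤ Mℤ +ℤ_) (P.sym (P.trans (ℤP.pos-+ (toℕ s) (n ℕ.* M)) (cong (+ toℕ s +ℤ_) (ℤP.pos-* n M)))))
    where
    s+[w+n]*M≡w*M+[s+n*M] : ∀ s w n m → s +ℤ (w +ℤ n) *ℤ m ≡ w *ℤ m +ℤ (s +ℤ n *ℤ m)
    s+[w+n]*M≡w*M+[s+n*M] = solve-∀

  residue-+ : ∀ (s : Fin M) n → fromℕ< (ℕD.m%n<n (toℕ s ℕ.+ n ℕ.* M) M) ≡ s
  residue-+ s n = FP.toℕ-injective (P.trans (FP.toℕ-fromℕ< (ℕD.m%n<n (toℕ s ℕ.+ n ℕ.* M) M))
                                            (P.trans (ℕD.[m+kn]%n≡m%n (toℕ s) n M) (ℕD.m<n⇒m%n≡m (FP.toℕ<n s))))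

  quotient-+ : ∀ (s : Fin M) n → (toℕ s ℕ.+ n ℕ.* M) / M ≡ n
  quotient-+ s n = P.trans (ℕD.+-distrib-/ (toℕ s) (n ℕ.* M) no-carry)
                           (P.cong₂ ℕ._+_ (ℕD.m<n⇒m/n≡0 (FP.toℕ<n s)) (ℕD.m*n/n≡m n M))
    where
    no-carry : toℕ s % M ℕ.+ (n ℕ.* M) % M ℕ.< M
    no-carry = P.subst (ℕ._< M) (P.sym (P.cong₂ ℕ._+_ (ℕD.m<n⇒m%n≡m (FP.toℕ<n s)) (ℕD.m*n%n≡0 n M)))
                       (P.subst (ℕ._< M) (P.sym (ℕP.+-identityʳ (toℕ s))) (FP.toℕ<n s))

  i≤∣i∣*M : ∀ i → i ≤ℤ + ∣ i ∣ *ℤ Mℤ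
  i≤∣i∣*M i = ℤP.≤-trans (i≤+∣i∣ i) (P.subst (+ ∣ i ∣ ≤ℤ_) (ℤP.pos-* ∣ i ∣ M) (+≤+ (ℕP.m≤m*n ∣ i ∣ M)))

module SumsInL {c ℓ c′ ℓ′} {k : Field c ℓ} {k′ : Field c′ ℓ′} (E : FiniteExt k k′) where
  open DoubleSeries E
  open Endomorphisms E
  private module LSum = FiniteSums U.ring
  module KtSum = FiniteSums T.ring

  -- Abstract, so that unification never unfolds a sum over Fin (suc m′) into series arithmetic.
  abstract
    Σ : ∀ {n} → (Fin n → L) → L
    Σ = LSum.sum

    sumFin≋Σ : ∀ {n} (G : Fin n → L) → sumFin Lring n G ≋ Σ G
    sumFin≋Σ {n} G = U.≡⇒≋ (LSum.sumFin≡sum n G)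

    col-Σ : ∀ {n} (G : Fin n → L) j → U.coef (Σ G) j T.≋ KtSum.sum (λ r → U.coef (G r) j)
    col-Σ {zero} G j = col-0 j
    col-Σ {suc n} G j = T.≋-trans (col-+ (G F.zero) (Σ (G ∘ F.suc)) j)
      (T.+ₗ-cong {U.coef (G F.zero) j} {U.coef (G F.zero) j} {U.coef (Σ (G ∘ F.suc)) j} {KtSum.sum (λ r → U.coef (G (F.suc r)) j)}
                 T.≋-refl (col-Σ (G ∘ F.suc) j))

    IsEnd′-Σ : ∀ {n} (A : Fin n → L → L) → (∀ i → IsEnd′ (A i)) → IsEnd′ (λ f → Σ (λ i → A i f))
    IsEnd′-Σ {zero} A A-end = IsEnd′-0
    IsEnd′-Σ {suc n} A A-end = IsEnd′-+ {A F.zero} {λ f → Σ (λ i → A (F.suc i) f)} (A-end F.zero) (IsEnd′-Σ (A ∘ F.suc) (A-end ∘ F.suc))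

    Σ-cong : ∀ {n} {G H : Fin n → L} → (∀ i → G i ≋ H i) → Σ G ≋ Σ H
    Σ-cong {n} {G} {H} G≋H = mk≋ (LSum.sum-cong-≋ {n} {G} {H} (λ i → get (G≋H i)))

    Σ-+ : ∀ {n} (G H : Fin n → L) → Σ (λ i → G i +L H i) ≋ (Σ G +L Σ H)
    Σ-+ G H = mk≋ (LSum.∑-distrib-+ G H)

    Σ-*ˡ : ∀ {n} x (G : Fin n → L) → (x *L Σ G) ≋ Σ (λ i → x *L G i)
    Σ-*ˡ x G = mk≋ (LSum.*-distribˡ-sum x G)

    Σ-*ʳ : ∀ {n} x (G : Fin n → L) → (Σ G *L x) ≋ Σ (λ i → G i *L x)
    Σ-*ʳ x G = mk≋ (LSum.*-distribʳ-sum x G)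

    Σ-0 : ∀ n → Σ {n} (λ _ → 0L) ≋ 0L
    Σ-0 n = mk≋ (LSum.sum-replicate-zero n)

    Σ-neg : ∀ {n} (G : Fin n → L) → Σ (λ i → -L G i) ≋ (-L Σ G)
    Σ-neg G = mk≋ (LSum.sum-neg G)

    Σ-comm : ∀ {n m} (G : Fin n → Fin m → L) → Σ (λ i → Σ (λ j → G i j)) ≋ Σ (λ j → Σ (λ i → G i j))
    Σ-comm G = mk≋ (LSum.∑-comm G)

    Σ-δ : ∀ {n} (s : Fin n) (G : Fin n → L) → Σ (λ r → if does (s F.≟ r) then G r else 0L) ≋ G s
    Σ-δ s G = mk≋ (LSum.sum-δ s G)

    Σ-· : ∀ {n} a (G : Fin n → L) → (a ·L Σ G) ≋ Σ (λ i → a ·L G i)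
    Σ-· {zero} a G = ·-zeroʳ a
    Σ-· {suc n} a G = ≋-trans (·-distribˡ a (G F.zero) (Σ (G ∘ F.suc)))
                            (U.+ₗ-cong {a ·L G F.zero} {a ·L G F.zero} ≋-refl (Σ-· a (G ∘ F.suc)))


module Decimation {c ℓ c′ ℓ′} {k : Field c ℓ} {k′ : Field c′ ℓ′} (E : FiniteExt k k′) (m′ : ℕ) where
  open DoubleSeries E
  open Endomorphisms E
  open Residues m′
  open SumsInL E
  open LS
  open k′ using () renaming (_≈_ to _≈′_; 0# to 0′)

  ≋-by-idx : ∀ {f g} → (∀ j s → U.coef f (idx j s) T.≋ U.coef g (idx j s)) → f ≋ g
  ≋-by-idx {f} {g} f≋g = mk≋ (∀-idx {Q = λ i → U.coef f i Kt.≈ U.coef g i} (λ j s → T.get (f≋g j s)))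

  abstract
    component : Fin M → L → L
    component s f = ls (val f /ℕ M) (λ n → U.coef f (idx ((val f /ℕ M) +ℤ + n) s))

    col-component : ∀ s f j → U.coef (component s f) j ≡ U.coef f (idx j s)
    col-component s f j with offset (val f /ℕ M) j
    ... | below j<v = P.trans (U.coef-below (component s f) j j<v)
                              (P.sym (U.coef-below f (idx j s) (ℤP.<-≤-trans (idx-< j _ s j<v) (ℤD.[n/ℕd]*d≤n (val f) M))))
    ... | at n P.refl = U.coef-at (component s f) n

    lowerBound : (Fin M → L) → ℤ
    lowerBound h = minᶠ (λ r → val (h r))

    interleave : (Fin M → L) → L
    interleave h = ls (lowerBound h *ℤ Mℤ) (λ n → U.coef (h (fromℕ< (ℕD.m%n<n n M))) (lowerBound h +ℤ + (n / M)))

    col-interleave : ∀ h j s → U.coef (interleave h) (idx j s) ≡ U.coef (h s) j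
    col-interleave h j s with offset (lowerBound h) j
    ... | below j<v = P.trans (U.coef-below (interleave h) (idx j s) (idx-< j (lowerBound h) s j<v))
                              (P.sym (U.coef-below (h s) j (ℤP.<-≤-trans j<v (minᶠ≤ (λ r → val (h r)) s))))
    ... | at n P.refl = P.trans (cong (U.coef (interleave h)) (idx-+ (lowerBound h) n s))
                          (P.trans (U.coef-at (interleave h) (toℕ s ℕ.+ n ℕ.* M))
                                   (P.cong₂ (λ r q → U.coef (h r) (lowerBound h +ℤ + q)) (residue-+ s n) (quotient-+ s n)))

  component-interleave : ∀ h s → component s (interleave h) ≋ h s
  component-interleave h s = mk≋ (λ j → T.get (T.≡⇒≋ (P.trans (col-component s (interleave h) j) (col-interleave h j s))))

  interleave-component : ∀ f → interleave (λ s → component s f) ≋ f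
  interleave-component f = ≋-by-idx (λ j s → T.≡⇒≋ (P.trans (col-interleave (λ s → component s f) j s) (col-component s f j)))

  component-cong : ∀ s {f g} → f ≋ g → component s f ≋ component s g
  component-cong s {f} {g} f≋g = mk≋ (λ j → T.get (
    T.≋-trans (T.≡⇒≋ (col-component s f j)) (T.≋-trans (col-≋ f≋g (idx j s)) (T.≡⇒≋ (P.sym (col-component s g j))))))

  component-+ : ∀ s f g → component s (f +L g) ≋ (component s f +L component s g)
  component-+ s f g = mk≋ (λ j → T.get (
    T.≋-trans (T.≡⇒≋ (col-component s (f +L g) j))
    (T.≋-trans (col-+ f g (idx j s))
    (T.≋-trans (T.≡⇒≋ (P.cong₂ Kt._+_ (P.sym (col-component s f j)) (P.sym (col-component s g j))))
    (T.≋-sym (col-+ (component s f) (component s g) j))))))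

  component-· : ∀ a s f → component s (a ·L f) ≋ (a ·L component s f)
  component-· a s f = mk≋ (λ j → T.get (
    T.≋-trans (T.≡⇒≋ (col-component s (a ·L f) j))
    (T.≋-trans (col-· a f (idx j s))
    (T.≋-trans (T.≡⇒≋ (cong (mapLS k′.rawRing (FiniteExt.ι E a k′.*_)) (P.sym (col-component s f j))))
    (T.≋-sym (col-· a (component s f) j))))))

  interleave-cong : ∀ {h h′} → (∀ s → h s ≋ h′ s) → interleave h ≋ interleave h′
  interleave-cong {h} {h′} h≋h′ = ≋-by-idx (λ j s →
    T.≋-trans (T.≡⇒≋ (col-interleave h j s)) (T.≋-trans (col-≋ (h≋h′ s) j) (T.≡⇒≋ (P.sym (col-interleave h′ j s)))))

  interleave-+ : ∀ h h′ → interleave (λ s → h s +L h′ s) ≋ (interleave h +L interleave h′)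
  interleave-+ h h′ = ≋-by-idx (λ j s →
    T.≋-trans (T.≡⇒≋ (col-interleave (λ s → h s +L h′ s) j s))
    (T.≋-trans (col-+ (h s) (h′ s) j)
    (T.≋-trans (T.≡⇒≋ (P.cong₂ Kt._+_ (P.sym (col-interleave h j s)) (P.sym (col-interleave h′ j s))))
    (T.≋-sym (col-+ (interleave h) (interleave h′) (idx j s))))))

  interleave-· : ∀ a h → interleave (λ s → a ·L h s) ≋ (a ·L interleave h)
  interleave-· a h = ≋-by-idx (λ j s →
    T.≋-trans (T.≡⇒≋ (col-interleave (λ s → a ·L h s) j s))
    (T.≋-trans (col-· a (h s) j)
    (T.≋-trans (T.≡⇒≋ (cong (mapLS k′.rawRing (FiniteExt.ι E a k′.*_)) (P.sym (col-interleave h j s))))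
    (T.≋-sym (col-· a (interleave h) (idx j s))))))

  interleave-neg : ∀ h → interleave (λ s → -L h s) ≋ (-L interleave h)
  interleave-neg h = ≋-by-idx (λ j s →
    T.≋-trans (T.≡⇒≋ (col-interleave (λ s → -L h s) j s))
    (T.≋-trans (col-neg (h s) j)
    (T.≋-trans (T.≡⇒≋ (cong Kt.-_ (P.sym (col-interleave h j s))))
    (T.≋-sym (col-neg (interleave h) (idx j s))))))

  interleave-0 : interleave (λ _ → 0L) ≋ 0L
  interleave-0 = ≋-by-idx (λ j s →
    T.≋-trans (T.≡⇒≋ (col-interleave (λ _ → 0L) j s)) (T.≋-trans (col-0 j) (T.≋-sym (col-0 (idx j s)))))

  coeffL-component : ∀ s f i j → coeffL (component s f) i j ≡ coeffL f i (idx j s)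
  coeffL-component s f i j = cong (λ z → T.coef z i) (col-component s f j)

  coeffL-interleave : ∀ h i j s → coeffL (interleave h) i (idx j s) ≡ coeffL (h s) i j
  coeffL-interleave h i j s = cong (λ z → T.coef z i) (col-interleave h j s)

  component-O : ∀ s f n → f ∈O n → component s f ∈O (n /ℕ M)
  component-O s f n f∈O i j j<n/M =
    k′.trans (k′.reflexive (coeffL-component s f i j)) (f∈O i (idx j s) (ℤP.<-≤-trans (idx-< j (n /ℕ M) s j<n/M) (ℤD.[n/ℕd]*d≤n n M)))

  component-O* : ∀ s f q → f ∈O (q *ℤ Mℤ) → component s f ∈O q
  component-O* s f q f∈O i j j<q = k′.trans (k′.reflexive (coeffL-component s f i j)) (f∈O i (idx j s) (idx-< j q s j<q))

  component-T : ∀ s f l q → f ∈t^ l +O (q *ℤ Mℤ) → component s f ∈t^ l +O q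
  component-T s f l q f∈T i j j<q i<l = k′.trans (k′.reflexive (coeffL-component s f i j)) (f∈T i (idx j s) (idx-< j q s j<q) i<l)

  interleave-O : ∀ h q → (∀ s → h s ∈O q) → interleave h ∈O (q *ℤ Mℤ)
  interleave-O h q h∈O i = ∀-idx {Q = λ z → z <ℤ q *ℤ Mℤ → coeffL (interleave h) i z ≈′ 0′}
    (λ j s idx<qM → k′.trans (k′.reflexive (coeffL-interleave h i j s)) (h∈O s i j (idx-<⁻¹ j q s idx<qM)))

  interleave-T : ∀ h l q → (∀ s → h s ∈t^ l +O q) → interleave h ∈t^ l +O (q *ℤ Mℤ)
  interleave-T h l q h∈T i = ∀-idx {Q = λ z → z <ℤ q *ℤ Mℤ → i <ℤ l → coeffL (interleave h) i z ≈′ 0′}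
    (λ j s idx<qM i<l → k′.trans (k′.reflexive (coeffL-interleave h i j s)) (h∈T s i j (idx-<⁻¹ j q s idx<qM) i<l))

  IsEnd′-component : ∀ s → IsEnd′ (component s)
  IsEnd′-component s = record
    { linear = kLinear (component-cong s) (component-+ s) (λ a f → component-· a s f)
    ; mapsFrom = λ n → n /ℕ M , λ f f∈O → component-O s f n f∈O
    ; mapsInto = λ q → q *ℤ Mℤ , λ f f∈O → component-O* s f q f∈O
    ; continuous = λ n q l → q *ℤ Mℤ , l , λ g _ g∈T → component-T s g l q g∈T }

  single : Fin M → L → Fin M → L
  single r x s = if does (r F.≟ s) then x else 0L

  inject : Fin M → L → L
  inject r x = interleave (single r x)

  component-inject : ∀ s f → component s (inject s f) ≋ f
  component-inject s f = ≋-trans (component-interleave (single s f) s) (≡⇒≋ (if-does-yes (s F.≟ s) P.refl))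
    where open U using (≡⇒≋)

  IsEnd′-inject : ∀ r → IsEnd′ (inject r)
  IsEnd′-inject r = record
    { linear = kLinear (λ f≋g → interleave-cong (λ s → if-≋ (does (r F.≟ s)) f≋g))
                       (λ f g → ≋-trans (interleave-cong (λ s → if-+ (does (r F.≟ s)) f g)) (interleave-+ (single r f) (single r g)))
                       (λ a f → ≋-trans (interleave-cong (λ s → if-· (does (r F.≟ s)) a f)) (interleave-· a (single r f)))
    ; mapsFrom = λ n → n *ℤ Mℤ , λ f f∈O → interleave-O (single r f) n (λ s → if-O (does (r F.≟ s)) f∈O)
    ; mapsInto = λ q → + ∣ q ∣ , λ f f∈O → O-weaken (inject r f) (i≤∣i∣*M q) (interleave-O (single r f) (+ ∣ q ∣) (λ s → if-O (does (r F.≟ s)) f∈O))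
    ; continuous = λ n q l → + ∣ q ∣ , l , λ g _ g∈T →
        T-weaken (inject r g) ℤP.≤-refl (i≤∣i∣*M q) (interleave-T (single r g) l (+ ∣ q ∣) (λ s → if-T (does (r F.≟ s)) g∈T)) }
    where
    if-≋ : ∀ b {x y} → x ≋ y → (if b then x else 0L) ≋ (if b then y else 0L)
    if-≋ true x≋y = x≋y
    if-≋ false _ = ≋-refl
    if-+ : ∀ b x y → (if b then x +L y else 0L) ≋ ((if b then x else 0L) +L (if b then y else 0L))
    if-+ true x y = ≋-refl
    if-+ false x y = ≋-sym (U.+ₗ-identityˡ 0L)
    if-· : ∀ b a x → (if b then a ·L x else 0L) ≋ (a ·L (if b then x else 0L))
    if-· true a x = ≋-refl
    if-· false a x = ≋-sym (·-zeroʳ a)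
    if-O : ∀ b {x n} → x ∈O n → (if b then x else 0L) ∈O n
    if-O true x∈O = x∈O
    if-O false {n = n} _ = O-0 n
    if-T : ∀ b {x l n} → x ∈t^ l +O n → (if b then x else 0L) ∈t^ l +O n
    if-T true x∈T = x∈T
    if-T false {l = l} {n} _ = T-0 l n

  interleave-sum : ∀ h → interleave h ≋ Σ (λ r → inject r (h r))
  interleave-sum h = ≋-by-idx col≋
    where
    col≋ : ∀ j s → U.coef (interleave h) (idx j s) T.≋ U.coef (Σ (λ r → inject r (h r))) (idx j s)
    col≋ j s = begin
      U.coef (interleave h) (idx j s)                 ≡⟨ col-interleave h j s ⟩
      U.coef (h s) j                                  ≈⟨ T.mk≋ (KtSum.sum-δ′ s (λ r → U.coef (h r) j)) ⟨
      KtSum.sum δ-terms                               ≈⟨ T.mk≋ (KtSum.sum-cong-≋ {M} {inject-terms} {δ-terms} col-inject) ⟨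
      KtSum.sum inject-terms                          ≈⟨ col-Σ (λ r → inject r (h r)) (idx j s) ⟨
      U.coef (Σ (λ r → inject r (h r))) (idx j s)   ∎
      where
      open T.≋-Reasoning
      δ-terms inject-terms : Fin M → Kt.Carrier
      δ-terms r = if does (r F.≟ s) then U.coef (h r) j else Kt.0#
      inject-terms r = U.coef (inject r (h r)) (idx j s)
      col-if : ∀ r b → U.coef (if b then h r else 0L) j T.≋ (if b then U.coef (h r) j else Kt.0#)
      col-if r true = T.≋-refl
      col-if r false = col-0 j
      col-inject : ∀ r → inject-terms r Kt.≈ δ-terms r
      col-inject r = T.get (T.≋-trans (T.≡⇒≋ (col-interleave (single r (h r)) j s)) (col-if r (does (r F.≟ s))))


module Multiplication {c ℓ c′ ℓ′} {k : Field c ℓ} {k′ : Field c′ ℓ′} (E : FiniteExt k k′) where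
  open DoubleSeries E
  open Endomorphisms E
  open LS

  -- Only the columns of a and g in u-degrees below K - q and K - p enter the
  -- coefficients of a g in u-degrees below K.
  *-∈t^+O : ∀ a g p q K α β → U.VanishesBelow a p → U.VanishesBelow g q →
            (∀ j → j +ℤ q <ℤ K → T.VanishesBelow (U.coef a j) α) →
            (∀ j → j +ℤ p <ℤ K → T.VanishesBelow (U.coef g j) β) →
            (a *L g) ∈t^ α +ℤ β +O K
  *-∈t^+O a g p q K α β a↓p g↓q a-cols g-cols = T-resp (≋-sym ag≋mulFrom) mulFrom∈T
    where
    ag≋mulFrom : (a *L g) ≋ U.mulFrom p q a g
    ag≋mulFrom = ≋-trans (U.*≋mulFrom a g) (U.mulFrom-irrelevant a g (U.vanishesBelow-val a) a↓p (U.vanishesBelow-val g) g↓q)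
    A = co (U.reindex p a)
    G = co (U.reindex q g)
    mulFrom∈T : U.mulFrom p q a g ∈t^ α +ℤ β +O K
    mulFrom∈T i j j<K i<α+β with offset (p +ℤ q) j
    ... | below j<p+q = k′.trans (k′.reflexive (cong (λ z → T.coef z i) (U.coef-below (U.mulFrom p q a g) j j<p+q))) (T.coef-0 i)
    ... | at n P.refl = k′.trans (k′.reflexive (cong (λ z → T.coef z i) (U.coef-at (U.mulFrom p q a g) n)))
            (T.vanishesBelow-sum n (λ x → A x Kt.* G (n ∸ x)) (α +ℤ β)
               (λ x x≤n → T.vanishesBelow-* {A x} {G (n ∸ x)} {α} {β} (A↓α x x≤n) (G↓β x x≤n)) i i<α+β)
      where
      [p+x]+q≡[p+q]+x : ∀ p q x → (p +ℤ x) +ℤ q ≡ (p +ℤ q) +ℤ x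
      [p+x]+q≡[p+q]+x = solve-∀
      [q+x]+p≡[p+q]+x : ∀ p q x → (q +ℤ x) +ℤ p ≡ (p +ℤ q) +ℤ x
      [q+x]+p≡[p+q]+x = solve-∀
      A↓α : ∀ x → x ℕ.≤ n → T.VanishesBelow (A x) α
      A↓α x x≤n = a-cols (p +ℤ + x) (ℤP.≤-<-trans (P.subst (_≤ℤ (p +ℤ q) +ℤ + n) (P.sym ([p+x]+q≡[p+q]+x p q (+ x)))
                                                     (ℤP.+-monoʳ-≤ (p +ℤ q) (+≤+ x≤n))) j<K)
      G↓β : ∀ x → x ℕ.≤ n → T.VanishesBelow (G (n ∸ x)) β
      G↓β x x≤n = g-cols (q +ℤ + (n ∸ x)) (ℤP.≤-<-trans (P.subst (_≤ℤ (p +ℤ q) +ℤ + n) (P.sym ([q+x]+p≡[p+q]+x p q (+ (n ∸ x))))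
                                                           (ℤP.+-monoʳ-≤ (p +ℤ q) (+≤+ (ℕP.m∸n≤m n x)))) j<K)

  i+j<k⇒i<k-j : ∀ i j k → i +ℤ j <ℤ k → i <ℤ k -ℤ j
  i+j<k⇒i<k-j i j k i+j<k = P.subst (_<ℤ k -ℤ j) ([i+j]-j≡i i j) (ℤP.+-monoˡ-< (ℤ.- j) i+j<k)
    where
    [i+j]-j≡i : ∀ i j → (i +ℤ j) -ℤ j ≡ i
    [i+j]-j≡i = solve-∀

  IsEnd′-* : ∀ a → IsEnd′ (a *L_)
  IsEnd′-* a = record
    { linear = kLinear (λ {f} {g} f≋g → U.*ₗ-cong {a} {a} {f} {g} ≋-refl f≋g) (U.*ₗ-distribˡ a) (λ b g → ≋-sym (·-*ˡ b a g))
    ; mapsFrom = λ n → val a +ℤ n , λ g g∈O →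
        vanishesBelow⇒O (a *L g) _ (U.vanishesBelow-* {a} {g} (U.vanishesBelow-val a) (O⇒vanishesBelow g n g∈O))
    ; mapsInto = λ m → m -ℤ val a , λ g g∈O → P.subst (λ z → (a *L g) ∈O z) (i+[j-i]≡j (val a) m)
        (vanishesBelow⇒O (a *L g) _ (U.vanishesBelow-* {a} {g} (U.vanishesBelow-val a) (O⇒vanishesBelow g _ g∈O)))
    ; continuous = continuous }
    where
    -- Finitely many columns of a matter, so their t-orders have a minimum α.
    continuous : Continuous (a *L_)
    continuous n m l = m -ℤ p , l -ℤ α , a*-cont
      where
      p = val a
      D = ∣ m -ℤ (p +ℤ n) ∣
      α = minᶠ {D} (λ r → val (co a (toℕ r)))
      α≤ : ∀ x → x ℕ.≤ D → α ≤ℤ val (co a x)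
      α≤ x x≤D = P.subst (λ y → α ≤ℤ val (co a y)) (FP.toℕ-fromℕ< (s≤s x≤D)) (minᶠ≤ _ (fromℕ< (s≤s x≤D)))
      a-cols : ∀ j → j +ℤ n <ℤ m → T.VanishesBelow (U.coef a j) α
      a-cols j j+n<m with offset p j
      ... | below j<p = λ i _ → k′.trans (k′.reflexive (cong (λ z → T.coef z i) (U.coef-below a j j<p))) (T.coef-0 i)
      ... | at x P.refl = λ i i<α → k′.trans (k′.reflexive (cong (λ z → T.coef z i) (U.coef-at a x)))
              (T.vanishesBelow-val (co a x) i (ℤP.<-≤-trans i<α (α≤ x x≤D)))
        where
        [p+x]+n≡x+[p+n] : ∀ p x n → (p +ℤ x) +ℤ n ≡ x +ℤ (p +ℤ n)
        [p+x]+n≡x+[p+n] = solve-∀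
        x≤D : x ℕ.≤ D
        x≤D = ℤP.drop‿+≤+ (ℤP.≤-trans (ℤP.<⇒≤ (i+j<k⇒i<k-j (+ x) (p +ℤ n) m (P.subst (_<ℤ m) ([p+x]+n≡x+[p+n] p (+ x) n) j+n<m)))
                                      (i≤+∣i∣ _))
      a*-cont : ∀ g → g ∈O n → g ∈t^ l -ℤ α +O (m -ℤ p) → (a *L g) ∈t^ l +O m
      a*-cont g g∈O g∈T = P.subst (λ z → (a *L g) ∈t^ z +O m) (i+[j-i]≡j α l)
        (*-∈t^+O a g p n m α (l -ℤ α) (U.vanishesBelow-val a) (O⇒vanishesBelow g n g∈O) a-cols
          (λ j j+p<m i i<l-α → g∈T i j (i+j<k⇒i<k-j j p m j+p<m) i<l-α))

module Embeddings {c ℓ c′ ℓ′} {k : Field c ℓ} {k′ : Field c′ ℓ′} (E : FiniteExt k k′) (m′ : ℕ) where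
  open DoubleSeries E
  open Endomorphisms E
  open EndAlgebra E
  open Multiplication E
  open Residues m′
  open Decimation E m′
  open SumsInL E

  End^M : RawKAlg k (c ⊔ˡ c′ ⊔ˡ ℓ′) (c′ ⊔ˡ ℓ′)
  End^M = End ^⊕ M
  module End^M = RawKAlg End^M

  blockDiagonal : End^M.Carrier → L → L
  blockDiagonal X f = interleave (λ r → proj₁ (X r) (component r f))

  blockDiagonal-isEnd : ∀ X → IsEnd (blockDiagonal X)
  blockDiagonal-isEnd X = IsEnd′⇒IsEnd (blockDiagonal X)
    (IsEnd′-resp (IsEnd′-Σ (λ r → inject r ∘ proj₁ (X r) ∘ component r)
                             (λ r → IsEnd′-∘ (IsEnd′-inject r) (IsEnd′-∘ {proj₁ (X r)} (IsEnd⇒IsEnd′ (proj₁ (X r)) (proj₂ (X r))) (IsEnd′-component r))))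
                 (λ f → interleave-sum (λ r → proj₁ (X r) (component r f))))

  ψ : End^M.Carrier → End.Carrier
  ψ X = blockDiagonal X , blockDiagonal-isEnd X

  ψ-injective : ∀ X Y → ψ X End.≈ ψ Y → ∀ i f → proj₁ (X i) f ≋ proj₁ (Y i) f
  ψ-injective X Y ψX≈ψY i f = begin
    proj₁ (X i) f                             ≈⟨ End-cong (X i) (component-inject i f) ⟨
    proj₁ (X i) (component i (inject i f))    ≈⟨ component-interleave (λ r → proj₁ (X r) (component r (inject i f))) i ⟨
    component i (blockDiagonal X (inject i f)) ≈⟨ component-cong i (≈ᴱ-elim {ψ X} {ψ Y} ψX≈ψY (inject i f)) ⟩
    component i (blockDiagonal Y (inject i f)) ≈⟨ component-interleave (λ r → proj₁ (Y r) (component r (inject i f))) i ⟩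
    proj₁ (Y i) (component i (inject i f))    ≈⟨ End-cong (Y i) (component-inject i f) ⟩
    proj₁ (Y i) f                             ∎
    where open U.≋-Reasoning

  ψ-isKAlgEmbedding : IsKAlgEmbedding End^M End ψ
  ψ-isKAlgEmbedding = record
    { isRingMonomorphism = record
      { isRingHomomorphism = record
        { isSemiringHomomorphism = record
          { isNearSemiringHomomorphism = record
            { +-isMonoidHomomorphism = record
              { isMagmaHomomorphism = record
                { isRelHomomorphism = record { cong = λ {X} {Y} X≈Y → ≈ᴱ-intro {ψ X} {ψ Y} λ f →
                    interleave-cong (λ r → ≈ᴱ-elim {X r} {Y r} (X≈Y r) (component r f)) }
                ; homo = λ X Y → ≈ᴱ-intro {ψ (X End^M.+ Y)} {ψ X End.+ ψ Y} λ f →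
                    interleave-+ (λ r → proj₁ (X r) (component r f)) (λ r → proj₁ (Y r) (component r f)) }
              ; ε-homo = ≈ᴱ-intro {ψ End^M.0#} {End.0#} (λ f → interleave-0) }
            ; *-homo = λ X Y → ≈ᴱ-intro {ψ (X End^M.* Y)} {ψ X End.* ψ Y} λ f →
                interleave-cong (λ r → End-cong (X r) (≋-sym (component-interleave (λ r′ → proj₁ (Y r′) (component r′ f)) r))) }
          ; 1#-homo = ≈ᴱ-intro {ψ End^M.1#} {End.1#} interleave-component }
        ; -‿homo = λ X → ≈ᴱ-intro {ψ (End^M.- X)} {End.- ψ X} λ f → interleave-neg (λ r → proj₁ (X r) (component r f)) }
      ; injective = λ {X} {Y} ψX≈ψY i → ≈ᴱ-intro {X i} {Y i} (ψ-injective X Y ψX≈ψY i) }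
    ; ·-homo = λ a X → ≈ᴱ-intro {ψ (a End^M.· X)} {a End.· ψ X} λ f → interleave-· a (λ r → proj₁ (X r) (component r f)) }

  module gl = RawKAlg (gl M)

  row : gl.Carrier → L → Fin M → L
  row x f r = Σ (λ s → x r s *L component s f)

  -- x ∈ gl(M, L) acts on L ≅ L^M as a matrix on column vectors.
  matrixAction : gl.Carrier → L → L
  matrixAction x f = interleave (row x f)

  matrixAction-isEnd : ∀ x → IsEnd (matrixAction x)
  matrixAction-isEnd x = IsEnd′⇒IsEnd (matrixAction x)
    (IsEnd′-resp (IsEnd′-Σ (λ r → inject r ∘ (λ f → row x f r))
                             (λ r → IsEnd′-∘ (IsEnd′-inject r) (IsEnd′-Σ (λ s → (x r s *L_) ∘ component s)
                                                                          (λ s → IsEnd′-∘ (IsEnd′-* (x r s)) (IsEnd′-component s)))))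
                 (λ f → interleave-sum (row x f)))

  φ : gl.Carrier → End.Carrier
  φ x = matrixAction x , matrixAction-isEnd x

  row-* : ∀ x y f r → row (x gl.* y) f r ≋ row x (matrixAction y f) r
  row-* x y f r = begin
    Σ (λ s → sumFin Lring M (λ t → x r t *L y t s) *L component s f)
      ≈⟨ Σ-cong (λ s → U.*ₗ-cong (sumFin≋Σ (λ t → x r t *L y t s)) (≋-refl {component s f})) ⟩
    Σ (λ s → Σ (λ t → x r t *L y t s) *L component s f)
      ≈⟨ Σ-cong (λ s → Σ-*ʳ (component s f) (λ t → x r t *L y t s)) ⟩
    Σ (λ s → Σ (λ t → (x r t *L y t s) *L component s f))
      ≈⟨ Σ-comm (λ s t → (x r t *L y t s) *L component s f) ⟩
    Σ (λ t → Σ (λ s → (x r t *L y t s) *L component s f))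
      ≈⟨ Σ-cong (λ t → Σ-cong (λ s → U.*ₗ-assoc (x r t) (y t s) (component s f))) ⟩
    Σ (λ t → Σ (λ s → x r t *L (y t s *L component s f)))
      ≈⟨ Σ-cong (λ t → Σ-*ˡ (x r t) (λ s → y t s *L component s f)) ⟨
    Σ (λ t → x r t *L row y f t)
      ≈⟨ Σ-cong (λ t → U.*ₗ-cong (≋-refl {x r t}) (component-interleave (row y f) t)) ⟨
    Σ (λ t → x r t *L component t (matrixAction y f)) ∎
    where
    open U.≋-Reasoning

  -- Column j of x is recovered by applying φ x to the j-th basis vector of L ≅ L^M.
  component-matrixAction-inject : ∀ x i j → component i (matrixAction x (inject j 1L)) ≋ x i j
  component-matrixAction-inject x i j = begin
    component i (matrixAction x (inject j 1L))                       ≈⟨ component-interleave (row x (inject j 1L)) i ⟩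
    Σ (λ s → x i s *L component s (inject j 1L))                   ≈⟨ Σ-cong (λ s → U.*ₗ-cong (≋-refl {x i s}) (component-interleave (single j 1L) s)) ⟩
    Σ (λ s → x i s *L (if does (j F.≟ s) then 1L else 0L))         ≈⟨ Σ-cong (λ s → *-δ (does (j F.≟ s)) (x i s)) ⟩
    Σ (λ s → if does (j F.≟ s) then x i s else 0L)                 ≈⟨ Σ-δ j (x i) ⟩
    x i j                                                            ∎
    where
    open U.≋-Reasoning
    *-δ : ∀ b y → (y *L (if b then 1L else 0L)) ≋ (if b then y else 0L)
    *-δ true y = U.*ₗ-identityʳ y
    *-δ false y = U.*ₗ-zeroʳ y

  φ-isKAlgEmbedding : IsKAlgEmbedding (gl M) End φ
  φ-isKAlgEmbedding = record
    { isRingMonomorphism = record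
      { isRingHomomorphism = record
        { isSemiringHomomorphism = record
          { isNearSemiringHomomorphism = record
            { +-isMonoidHomomorphism = record
              { isMagmaHomomorphism = record
                { isRelHomomorphism = record { cong = λ {x} {y} x≈y → ≈ᴱ-intro {φ x} {φ y} λ f →
                    interleave-cong (λ r → Σ-cong (λ s → U.*ₗ-cong (mk≋ {x r s} {y r s} (x≈y r s)) (≋-refl {component s f}))) }
                ; homo = λ x y → ≈ᴱ-intro {φ (x gl.+ y)} {φ x End.+ φ y} λ f →
                    ≋-trans (interleave-cong (λ r → ≋-trans (Σ-cong (λ s → U.*ₗ-distribʳ (component s f) (x r s) (y r s)))
                                                            (Σ-+ (λ s → x r s *L component s f) (λ s → y r s *L component s f))))
                            (interleave-+ (row x f) (row y f)) }
              ; ε-homo = ≈ᴱ-intro {φ gl.0#} {End.0#} λ f →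
                  ≋-trans (interleave-cong (λ r → ≋-trans (Σ-cong (λ s → U.*ₗ-zeroˡ (component s f))) (Σ-0 M))) interleave-0 }
            ; *-homo = λ x y → ≈ᴱ-intro {φ (x gl.* y)} {φ x End.* φ y} λ f → interleave-cong (row-* x y f) }
          ; 1#-homo = ≈ᴱ-intro {φ gl.1#} {End.1#} λ f →
              ≋-trans (interleave-cong (λ r → ≋-trans (Σ-cong (λ s → δ-* (does (r F.≟ s)) (component s f))) (Σ-δ r (λ s → component s f))))
                      (interleave-component f) }
        ; -‿homo = λ x → ≈ᴱ-intro {φ (gl.- x)} {End.- φ x} λ f →
            ≋-trans (interleave-cong (λ r → ≋-trans (Σ-cong (λ s → ≋-sym (U.-ₗ-distribˡ-* (x r s) (component s f))))
                                                    (Σ-neg (λ s → x r s *L component s f))))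
                    (interleave-neg (row x f)) }
      ; injective = λ {x} {y} φx≈φy i j → get (≋-trans (≋-sym (component-matrixAction-inject x i j))
          (≋-trans (component-cong i (≈ᴱ-elim {φ x} {φ y} φx≈φy (inject j 1L))) (component-matrixAction-inject y i j))) }
    ; ·-homo = λ a x → ≈ᴱ-intro {φ (a gl.· x)} {a End.· φ x} λ f →
        ≋-trans (interleave-cong (λ r → ≋-trans (Σ-cong (λ s → ≋-sym (·-*ʳ a (x r s) (component s f))))
                                                (≋-sym (Σ-· a (λ s → x r s *L component s f)))))
                (interleave-· a (row x f)) }
    where
    δ-* : ∀ b y → ((if b then 1L else 0L) *L y) ≋ (if b then y else 0L)
    δ-* true y = U.*ₗ-identityˡ y
    δ-* false y = U.*ₗ-zeroˡ y

proposition1 : ∀ {c ℓ c' ℓ'} (k : Field c ℓ) (k' : Field c' ℓ') (E : FiniteExt k k') →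
    let open Setup E in
    Σ[ cl ∈ EndClosed ]
      ( IsKAlgebra (EndAlg cl)
      × (∀ (m : ℕ) → 0 < m → ∃[ φ ] IsKAlgEmbedding (EndAlg cl ^⊕ m) (EndAlg cl) φ)
      × (∀ (m : ℕ) → 0 < m → ∃[ φ ] IsKAlgEmbedding (gl m) (EndAlg cl) φ) )
proposition1 k k' E =
    EndAlgebra.endClosed E
  , EndAlgebra.End-isKAlgebra E
  , (λ { (suc m′) _ → Embeddings.ψ E m′ , Embeddings.ψ-isKAlgEmbedding E m′ })
  , (λ { (suc m′) _ → Embeddings.φ E m′ , Embeddings.φ-isKAlgEmbedding E m′ })
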